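{- Let $S=\{i_1<i_2<\cdots<i_s\}$ be a nonempty admissible set, and let $S_1=S\setminus\{i_s\}$ and $S_2=S_1\cup\{i_s-1\}$. Then \[\#\widehat{P}_B(S,n)=\binom{n}{i_s-1}\,\#\widehat{P}_B(S_1,i_s-1)\,2^{2(n-i_s)+1}-\#\widehat{P}_B(S_1,n)-\#\widehat{P}_B(S_2,n).\]
   Context: For $n\ge1$ (and $B_0$ consisting of the empty word), $B_n$ is the set of signed permutations $\pi=\pi_1\cdots\pi_n$: words with each $\pi_i\in\{ -n,\dots,-1,1,\dots,n\}$ and $\{|\pi_1|,\dots,|\pi_n|\}=\{1,\dots,n\}$. Set $\pi_0=0$. An index $i\in\{1,\dots,n-1\}$ is a peak of $\pi$ if $\pi_{i-1}<\pi_i>\pi_{i+1}$ (so $1$ is a peak iff $0<\pi_1>\pi_2$). $\widehat{P}_B(S,n)$ is the set of $\pi\in B_n$ whose peak set (in this sense) equals $S$. $S$ is $n$-admissible if $\widehat{P}_B(S,n)\neq\emptyset$, and admissible if $n$-admissible for some $n$; the identity is asserted for every $n$ for which $S$ is $n$-admissible. -}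

module Defs where

open import Data.Bool using (Bool; true; false; _∧_; _∨_; not; if_then_else_)
open import Data.Nat using (ℕ; zero; suc; _∸_; _≡ᵇ_)
open import Data.Integer using (ℤ; +_; -_; ∣_∣; _<?_)
open import Data.List using (List; []; _∷_; _++_; map; concatMap; filter; length; upTo)
open import Data.Bool.ListAction using (all; any)
open import Data.Bool using (T?)
open import Relation.Nullary.Decidable using (does)
open import Function using (_∘_)

_∈ᵇ_ : ℕ → List ℕ → Bool
x ∈ᵇ xs = any (x ≡ᵇ_) xs

_≈ˢ_ : List ℕ → List ℕ → Bool
xs ≈ˢ ys = all (_∈ᵇ ys) xs ∧ all (_∈ᵇ xs) ys

distinct : List ℕ → Bool
distinct []       = true
distinct (x ∷ xs) = not (x ∈ᵇ xs) ∧ distinct xs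

alphabet : ℕ → List ℤ
alphabet n = map (λ k → - (+ suc k)) (upTo n) ++ map (λ k → + suc k) (upTo n)

words : ℕ → List ℤ → List (List ℤ)
words zero    A = [] ∷ []
words (suc k) A = concatMap (λ a → map (a ∷_) (words k A)) A

-- a word of length n over {±1..±n} is a signed permutation iff |π_i| are distinct
isSigned : List ℤ → Bool
isSigned w = distinct (map ∣_∣ w)

B : ℕ → List (List ℤ)
B n = filter (λ w → T? (isSigned w)) (words n (alphabet n))

-- peaks of a word a₀ a₁ … a_m, where the first listed letter has index k-1:
-- index j (of the middle letter) is a peak iff a_{j-1} < a_j > a_{j+1}
peaksFrom : ℕ → List ℤ → List ℕ
peaksFrom k (a ∷ b ∷ c ∷ rest) =
  (if does (a <? b) ∧ does (c <? b) then k ∷ peaksFrom (suc k) (b ∷ c ∷ rest)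
                           else peaksFrom (suc k) (b ∷ c ∷ rest))
peaksFrom k _ = []

-- peak set of π = π₁⋯πₙ with π₀ = 0; indices range over 1..n-1
peakSet : List ℤ → List ℕ
peakSet π = peaksFrom 1 (+ 0 ∷ π)

PB : List ℕ → ℕ → List (List ℤ)
PB S n = filter (λ π → T? (peakSet π ≈ˢ S)) (B n)

countPB : List ℕ → ℕ → ℕ
countPB S n = length (PB S n)

module Submission where

-- Since 0 is never a peak, iₛ = k+1, and since peaks are never adjacent, S₁ < k.
-- Cut π ∈ B_n after its first k letters.  Then π has peak set S₁ ∪ {k+1}, S₁ or S₁ ∪ {k} --
-- and then exactly one of them -- iff its prefix has peak set S₁ and its suffix is peak-free
-- (peak-split).  Summing over B_n, the three counts add up to the sum of
-- [peak set of prefix = S₁] · [suffix peak-free], a product of two weights depending only on the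
-- relative order of the letters.  Such a sum factorises as C(n,k) times the two separate sums
-- (product-formula), and there are 2^(2m+1) peak-free signed permutations of length m+1
-- (peakFree-count).

open import Defs
open import Data.Bool using (Bool; true; false; _∧_; _∨_; not; if_then_else_; T; T?)
open import Data.Bool.ListAction using (all)
open import Data.Bool.Properties using (T-≡; ∧-zeroʳ; ∧-identityʳ; ∨-identityʳ; ∨-zeroʳ; ∨-comm; ∨-assoc)
open import Data.Empty using (⊥; ⊥-elim)
open import Data.Integer using (ℤ; +_; _-_; -[1+_]; -_; ∣_∣; _<?_; -<-; -<+; +<+) renaming (_<_ to _<ℤ_; _+_ to _ℤ+_)
import Data.Integer.Properties as ℤ
open import Data.Integer.Properties using (<-cmp; <-asym; <-irrefl; <-trans)
open import Data.Integer.Tactic.RingSolver using () renaming (solve-∀ to ℤ-solve-∀)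
open import Data.List using (List; []; _∷_; _++_; map; concat; filter; length; take; drop; applyUpTo; upTo)
open import Data.List.Properties using (map-++; map-∘; map-cong; map-applyUpTo; length-map; take-map; drop-map)
open import Data.List.Relation.Binary.Permutation.Propositional using (_↭_; prep)
import Data.List.Relation.Binary.Permutation.Propositional.Properties as Perm
open import Data.List.Relation.Unary.All using (All; []; _∷_)
import Data.List.Relation.Unary.All as All
open import Data.List.Relation.Unary.Unique.Propositional using (Unique; []; _∷_)
import Data.List.Relation.Unary.Unique.Propositional.Properties as Unique
open import Data.Nat using (ℕ; zero; suc; _+_; _*_; _∸_; _^_; _<_; _≤_; z≤n; s≤s; _≡ᵇ_; _<ᵇ_; NonZero; ≢-nonZero⁻¹)
import Data.Nat.Properties as ℕ
open import Data.Nat.Properties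
  using (+-assoc; +-comm; +-suc; +-identityʳ; *-identityˡ; *-identityʳ; *-zeroʳ; *-distribˡ-+; *-distribʳ-+; *-assoc;
         m+[n∸m]≡n; m≤m+n; m<n⇒m<1+n; n<1+n)
open import Algebra.Properties.CommutativeSemigroup ℕ.+-commutativeSemigroup using () renaming (interchange to +-interchange)
open import Algebra.Properties.CommutativeSemigroup ℕ.*-commutativeSemigroup using () renaming (x∙yz≈y∙xz to *-exchange)
open import Data.Nat.Combinatorics using (_C_; nCn≡1; nCk+nC[k+1]≡[n+1]C[k+1])
open import Data.Nat.ListAction using (sum)
open import Data.Nat.ListAction.Properties using (sum-++; sum-↭)
open import Data.Nat.Tactic.RingSolver using (solve-∀)
open import Data.Product using (Σ; _×_; _,_; proj₁; proj₂)
open import Data.Sum using (inj₁; inj₂)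
open import Function using (_∘_; id)
open import Function.Bundles using (_⇔_; mk⇔; Equivalence)
open import Relation.Binary.Definitions using (tri<; tri≈; tri>)
open import Relation.Binary.PropositionalEquality
open import Relation.Nullary using (¬_)
open import Relation.Nullary.Decidable using (does; yes; no; dec-true; dec-false)

-- (1) Finite sums.  Counts are sums of indicators of Booleans.
χ : Bool → ℕ
χ true  = 1
χ false = 0

χ-∧ : ∀ b c → χ (b ∧ c) ≡ χ b * χ c
χ-∧ true  c = sym (+-identityʳ (χ c))
χ-∧ false c = refl

sumList : {A : Set} → (A → ℕ) → List A → ℕ
sumList f xs = sum (map f xs)

module _ {A : Set} where

  sumList-congAll : {P : A → Set} {f g : A → ℕ} {xs : List A} → All P xs →
                    (∀ x → P x → f x ≡ g x) → sumList f xs ≡ sumList g xs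
  sumList-congAll []         eq = refl
  sumList-congAll (px ∷ pxs) eq = cong₂ _+_ (eq _ px) (sumList-congAll pxs eq)

  sumList-cong : {f g : A → ℕ} (xs : List A) → (∀ x → f x ≡ g x) → sumList f xs ≡ sumList g xs
  sumList-cong []       eq = refl
  sumList-cong (x ∷ xs) eq = cong₂ _+_ (eq x) (sumList-cong xs eq)

  sumList-+ : (f g : A → ℕ) (xs : List A) →
              sumList (λ x → f x + g x) xs ≡ sumList f xs + sumList g xs
  sumList-+ f g []       = refl
  sumList-+ f g (x ∷ xs) = trans (cong (_+_ (f x + g x)) (sumList-+ f g xs)) (+-interchange (f x) (g x) _ _)

  sumList-* : (c : ℕ) (f : A → ℕ) (xs : List A) → sumList (λ x → c * f x) xs ≡ c * sumList f xs
  sumList-* c f []       = sym (*-zeroʳ c)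
  sumList-* c f (x ∷ xs) = trans (cong (_+_ (c * f x)) (sumList-* c f xs)) (sym (*-distribˡ-+ c (f x) _))

  sumList-++ : (f : A → ℕ) (xs ys : List A) → sumList f (xs ++ ys) ≡ sumList f xs + sumList f ys
  sumList-++ f xs ys = trans (cong sum (map-++ f xs ys)) (sum-++ (map f xs) (map f ys))

  sumList-↭ : (f : A → ℕ) {xs ys : List A} → xs ↭ ys → sumList f xs ≡ sumList f ys
  sumList-↭ f p = sum-↭ (Perm.map⁺ f p)

sumList-map : {A B : Set} (h : A → B) (f : B → ℕ) (xs : List A) → sumList f (map h xs) ≡ sumList (f ∘ h) xs
sumList-map h f xs = cong sum (sym (map-∘ xs))

sumList-zero : {A : Set} (xs : List A) → sumList (λ _ → 0) xs ≡ 0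
sumList-zero xs = sumList-* 0 (λ _ → 0) xs

sumList-filter : {A : Set} (p : A → Bool) (f : A → ℕ) (xs : List A) →
                 sumList f (filter (λ x → T? (p x)) xs) ≡ sumList (λ x → χ (p x) * f x) xs
sumList-filter p f []       = refl
sumList-filter p f (x ∷ xs) with p x
... | true  = cong₂ _+_ (sym (+-identityʳ (f x))) (sumList-filter p f xs)
... | false = sumList-filter p f xs

length-sumList : {A : Set} (xs : List A) → length xs ≡ sumList (λ _ → 1) xs
length-sumList []       = refl
length-sumList (x ∷ xs) = cong suc (length-sumList xs)

sumList-concat : {A : Set} (f : A → ℕ) (xss : List (List A)) → sumList f (concat xss) ≡ sumList (sumList f) xss
sumList-concat f []         = refl
sumList-concat f (xs ∷ xss) = trans (sumList-++ f xs (concat xss)) (cong (_+_ (sumList f xs)) (sumList-concat f xss))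

sumBelow : ℕ → (ℕ → ℕ) → ℕ
sumBelow zero    g = 0
sumBelow (suc L) g = g 0 + sumBelow L (g ∘ suc)

sumBelow-cong : (L : ℕ) {f g : ℕ → ℕ} → (∀ j → j < L → f j ≡ g j) → sumBelow L f ≡ sumBelow L g
sumBelow-cong zero    eq = refl
sumBelow-cong (suc L) eq = cong₂ _+_ (eq 0 (s≤s z≤n)) (sumBelow-cong L (λ j j<L → eq (suc j) (s≤s j<L)))

sumBelow-+ : (L : ℕ) (f g : ℕ → ℕ) → sumBelow L (λ j → f j + g j) ≡ sumBelow L f + sumBelow L g
sumBelow-+ zero    f g = refl
sumBelow-+ (suc L) f g = trans (cong (_+_ (f 0 + g 0)) (sumBelow-+ L (f ∘ suc) (g ∘ suc))) (+-interchange (f 0) (g 0) _ _)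

sumBelow-* : (L c : ℕ) (f : ℕ → ℕ) → sumBelow L (λ j → c * f j) ≡ c * sumBelow L f
sumBelow-* zero    c f = sym (*-zeroʳ c)
sumBelow-* (suc L) c f = trans (cong (_+_ (c * f 0)) (sumBelow-* L c (f ∘ suc))) (sym (*-distribˡ-+ c (f 0) _))

sumBelow-zero : (L : ℕ) → sumBelow L (λ _ → 0) ≡ 0
sumBelow-zero L = sumBelow-* L 0 (λ _ → 0)

sumBelow-split : (k m : ℕ) (f : ℕ → ℕ) → sumBelow (k + m) f ≡ sumBelow k f + sumBelow m (λ j → f (k + j))
sumBelow-split zero    m f = refl
sumBelow-split (suc k) m f = trans (cong (_+_ (f 0)) (sumBelow-split k m (f ∘ suc))) (sym (+-assoc (f 0) _ _))

sumList-sumBelow : {A : Set} (L : ℕ) (F : A → ℕ → ℕ) (xs : List A) →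
                   sumList (λ a → sumBelow L (F a)) xs ≡ sumBelow L (λ j → sumList (λ a → F a j) xs)
sumList-sumBelow zero    F xs = sumList-zero xs
sumList-sumBelow (suc L) F xs =
  trans (sumList-+ (λ a → F a 0) (λ a → sumBelow L (F a ∘ suc)) xs)
        (cong (_+_ (sumList (λ a → F a 0) xs)) (sumList-sumBelow L (λ a → F a ∘ suc) xs))

sumWords : ℕ → List ℤ → (List ℤ → ℕ) → ℕ
sumWords zero    A f = f []
sumWords (suc k) A f = sumList (λ a → sumWords k A (λ w → f (a ∷ w))) A

sumWords-congLength : (k : ℕ) (A : List ℤ) {f g : List ℤ → ℕ} →
                      (∀ w → length w ≡ k → f w ≡ g w) → sumWords k A f ≡ sumWords k A g
sumWords-congLength zero    A eq = eq [] refl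
sumWords-congLength (suc k) A eq =
  sumList-cong A (λ a → sumWords-congLength k A (λ w len → eq (a ∷ w) (cong suc len)))

sumWords-cong : (k : ℕ) (A : List ℤ) {f g : List ℤ → ℕ} → (∀ w → f w ≡ g w) → sumWords k A f ≡ sumWords k A g
sumWords-cong k A eq = sumWords-congLength k A (λ w _ → eq w)

sumWords-+ : (k : ℕ) (A : List ℤ) (f g : List ℤ → ℕ) →
             sumWords k A (λ w → f w + g w) ≡ sumWords k A f + sumWords k A g
sumWords-+ zero    A f g = refl
sumWords-+ (suc k) A f g = trans (sumList-cong A (λ a → sumWords-+ k A _ _)) (sumList-+ _ _ A)

sumWords-* : (k : ℕ) (A : List ℤ) (c : ℕ) (f : List ℤ → ℕ) →
             sumWords k A (λ w → c * f w) ≡ c * sumWords k A f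
sumWords-* zero    A c f = refl
sumWords-* (suc k) A c f = trans (sumList-cong A (λ a → sumWords-* k A c _)) (sumList-* c _ A)

sumWords-zero : (k : ℕ) (A : List ℤ) → sumWords k A (λ _ → 0) ≡ 0
sumWords-zero k A = sumWords-* k A 0 (λ _ → 0)

sumWords-map : (k : ℕ) (h : ℤ → ℤ) (A : List ℤ) (f : List ℤ → ℕ) →
               sumWords k (map h A) f ≡ sumWords k A (f ∘ map h)
sumWords-map zero    h A f = refl
sumWords-map (suc k) h A f = trans (sumList-map h _ A) (sumList-cong A (λ a → sumWords-map k h A _))

sumWords-↭ : (k : ℕ) {A A' : List ℤ} (f : List ℤ → ℕ) → A ↭ A' → sumWords k A f ≡ sumWords k A' f
sumWords-↭ zero    f p = refl
sumWords-↭ (suc k) {A} {A'} f p =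
  trans (sumList-↭ (λ a → sumWords k A (λ w → f (a ∷ w))) p)
        (sumList-cong A' (λ a → sumWords-↭ k (λ w → f (a ∷ w)) p))

sumList-words : (k : ℕ) (A : List ℤ) (f : List ℤ → ℕ) → sumList f (words k A) ≡ sumWords k A f
sumList-words zero    A f = +-identityʳ (f [])
sumList-words (suc k) A f = begin
  sumList f (concat (map (λ a → map (a ∷_) (words k A)) A))
    ≡⟨ sumList-concat f (map (λ a → map (a ∷_) (words k A)) A) ⟩
  sumList (sumList f) (map (λ a → map (a ∷_) (words k A)) A)
    ≡⟨ sumList-map (λ a → map (a ∷_) (words k A)) (sumList f) A ⟩
  sumList (λ a → sumList f (map (a ∷_) (words k A))) A
    ≡⟨ sumList-cong A (λ a → trans (sumList-map (a ∷_) f (words k A)) (sumList-words k A (λ w → f (a ∷ w)))) ⟩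
  sumList (λ a → sumWords k A (λ w → f (a ∷ w))) A ∎
  where open ≡-Reasoning

sumInj : ℕ → List ℤ → (List ℤ → ℕ) → ℕ
sumInj k A f = sumWords k A (λ w → χ (isSigned w) * f w)

sumB : ℕ → (List ℤ → ℕ) → ℕ
sumB n = sumInj n (alphabet n)

countPB-sumB : (S : List ℕ) (n : ℕ) → countPB S n ≡ sumB n (λ π → χ (peakSet π ≈ˢ S))
countPB-sumB S n = begin
  length (PB S n)
    ≡⟨ length-sumList (PB S n) ⟩
  sumList (λ _ → 1) (PB S n)
    ≡⟨ sumList-filter (λ π → peakSet π ≈ˢ S) _ (B n) ⟩
  sumList (λ π → χ (peakSet π ≈ˢ S) * 1) (B n)
    ≡⟨ sumList-filter isSigned _ (words n (alphabet n)) ⟩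
  sumList (λ π → χ (isSigned π) * (χ (peakSet π ≈ˢ S) * 1)) (words n (alphabet n))
    ≡⟨ sumList-words n (alphabet n) _ ⟩
  sumWords n (alphabet n) (λ π → χ (isSigned π) * (χ (peakSet π ≈ˢ S) * 1))
    ≡⟨ sumWords-cong n (alphabet n) (λ π → cong (χ (isSigned π) *_) (*-identityʳ _)) ⟩
  sumB n (λ π → χ (peakSet π ≈ˢ S)) ∎
  where open ≡-Reasoning

sumInj-cong : (k : ℕ) (A : List ℤ) {f g : List ℤ → ℕ} →
              (∀ w → isSigned w ≡ true → length w ≡ k → f w ≡ g w) → sumInj k A f ≡ sumInj k A g
sumInj-cong k A {f} {g} eq = sumWords-congLength k A (λ w len → signed-cong w len (isSigned w) refl)
  where
  signed-cong : ∀ w → length w ≡ k → (b : Bool) → isSigned w ≡ b → χ b * f w ≡ χ b * g w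
  signed-cong w len true  signed = cong (1 *_) (eq w signed len)
  signed-cong w len false _      = refl

sumInj-+ : (k : ℕ) (A : List ℤ) (f g : List ℤ → ℕ) → sumInj k A (λ w → f w + g w) ≡ sumInj k A f + sumInj k A g
sumInj-+ k A f g = trans (sumWords-cong k A (λ w → *-distribˡ-+ (χ (isSigned w)) (f w) (g w)))
                         (sumWords-+ k A (λ w → χ (isSigned w) * f w) (λ w → χ (isSigned w) * g w))

sumInj-* : (k : ℕ) (A : List ℤ) (c : ℕ) (f : List ℤ → ℕ) → sumInj k A (λ w → c * f w) ≡ c * sumInj k A f
sumInj-* k A c f = trans (sumWords-cong k A (λ w → *-exchange (χ (isSigned w)) c (f w)))
                         (sumWords-* k A c (λ w → χ (isSigned w) * f w))

-- (2) Classifying the words of an alphabet ±1, A (A without units) by the position of their unit.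

overUnits : (ℤ → ℕ) → ℕ
overUnits g = g -[1+ 0 ] + g (+ 1)

sumList-overUnits : {A : Set} (G : A → ℤ → ℕ) (xs : List A) →
                    sumList (λ a → overUnits (G a)) xs ≡ overUnits (λ s → sumList (λ a → G a s) xs)
sumList-overUnits G xs = sumList-+ (λ a → G a -[1+ 0 ]) (λ a → G a (+ 1)) xs

withUnits : List ℤ → List ℤ
withUnits A = -[1+ 0 ] ∷ + 1 ∷ A

NotUnit : ℤ → Set
NotUnit a = ∣ a ∣ ≢ 1

≢⇒≡ᵇ-false : ∀ {x y} → x ≢ y → (x ≡ᵇ y) ≡ false
≢⇒≡ᵇ-false {x} {y} x≢y with x ≡ᵇ y in e
... | true  = ⊥-elim (x≢y (ℕ.≡ᵇ⇒≡ x y (Equivalence.from T-≡ e)))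
... | false = refl

≡ᵇ-refl : ∀ x → (x ≡ᵇ x) ≡ true
≡ᵇ-refl x = Equivalence.to T-≡ (ℕ.≡⇒≡ᵇ x x refl)

-- Insertion of x into w at position j (at the end if j ≥ length w).
ins : {A : Set} → ℕ → A → List A → List A
ins zero    x w       = x ∷ w
ins (suc j) x []      = x ∷ []
ins (suc j) x (a ∷ w) = a ∷ ins j x w

map-ins : {A B : Set} (h : A → B) (j : ℕ) (x : A) (w : List A) → map h (ins j x w) ≡ ins j (h x) (map h w)
map-ins h zero    x w       = refl
map-ins h (suc j) x []      = refl
map-ins h (suc j) x (a ∷ w) = cong (h a ∷_) (map-ins h j x w)

∈ᵇ-ins : (x j y : ℕ) (ys : List ℕ) → (x ∈ᵇ ins j y ys) ≡ ((x ≡ᵇ y) ∨ (x ∈ᵇ ys))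
∈ᵇ-ins x zero    y ys       = refl
∈ᵇ-ins x (suc j) y []       = refl
∈ᵇ-ins x (suc j) y (z ∷ ys) = begin
  (x ≡ᵇ z) ∨ (x ∈ᵇ ins j y ys)         ≡⟨ cong ((x ≡ᵇ z) ∨_) (∈ᵇ-ins x j y ys) ⟩
  (x ≡ᵇ z) ∨ ((x ≡ᵇ y) ∨ (x ∈ᵇ ys))    ≡⟨ sym (∨-assoc (x ≡ᵇ z) (x ≡ᵇ y) _) ⟩
  ((x ≡ᵇ z) ∨ (x ≡ᵇ y)) ∨ (x ∈ᵇ ys)    ≡⟨ cong (_∨ (x ∈ᵇ ys)) (∨-comm (x ≡ᵇ z) (x ≡ᵇ y)) ⟩
  ((x ≡ᵇ y) ∨ (x ≡ᵇ z)) ∨ (x ∈ᵇ ys)    ≡⟨ ∨-assoc (x ≡ᵇ y) (x ≡ᵇ z) _ ⟩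
  (x ≡ᵇ y) ∨ ((x ≡ᵇ z) ∨ (x ∈ᵇ ys))    ∎
  where open ≡-Reasoning

prefixed : ℤ → (List ℤ → ℕ) → List ℤ → ℕ
prefixed a f w = χ (not (∣ a ∣ ∈ᵇ map ∣_∣ w)) * f (a ∷ w)

sumInj-cons : (k : ℕ) (A : List ℤ) (f : List ℤ → ℕ) →
              sumInj (suc k) A f ≡ sumList (λ a → sumInj k A (prefixed a f)) A
sumInj-cons k A f = sumList-cong A (λ a → sumWords-cong k A (λ w →
  χ-∧-* (not (∣ a ∣ ∈ᵇ map ∣_∣ w)) (isSigned w) (f (a ∷ w))))
  where
  χ-∧-* : ∀ b c x → χ (b ∧ c) * x ≡ χ c * (χ b * x)
  χ-∧-* true  c x = cong (χ c *_) (sym (*-identityˡ x))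
  χ-∧-* false c x = sym (*-zeroʳ (χ c))

insertedUnits : ℕ → List ℤ → (List ℤ → ℕ) → ℕ
insertedUnits k A f = sumBelow (suc k) (λ j → overUnits (λ s → sumInj k A (λ w → f (ins j s w))))

+-rearrange : ∀ a b x y → a + (b + (x + y)) ≡ x + ((a + b) + y)
+-rearrange = solve-∀

module _ (A : List ℤ) (notUnit : All NotUnit A) where

  avoid-units : (k : ℕ) (h : List ℤ → ℕ) →
                sumWords k (withUnits A) (λ w → χ (not (1 ∈ᵇ map ∣_∣ w)) * h w) ≡ sumWords k A h
  avoid-units zero    h = *-identityˡ (h [])
  avoid-units (suc k) h =
    cong₂ _+_ (sumWords-zero k (withUnits A))
      (cong₂ _+_ (sumWords-zero k (withUnits A))
        (sumList-congAll notUnit (λ a a≢1 →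
          trans (sumWords-cong k (withUnits A)
                  (λ w → cong (λ b → χ (not (b ∨ (1 ∈ᵇ map ∣_∣ w))) * h (a ∷ w)) (≢⇒≡ᵇ-false (≢-sym a≢1))))
                (avoid-units k (λ w → h (a ∷ w))))))

  unit-first : (k : ℕ) (s : ℤ) → ∣ s ∣ ≡ 1 → (f : List ℤ → ℕ) →
               sumInj k (withUnits A) (prefixed s f) ≡ sumInj k A (λ w → f (s ∷ w))
  unit-first k s ∣s∣≡1 f = trans
    (sumWords-cong k (withUnits A) (λ w → trans
      (*-exchange (χ (isSigned w)) (χ (not (∣ s ∣ ∈ᵇ map ∣_∣ w))) (f (s ∷ w)))
      (cong (λ m → χ (not (m ∈ᵇ map ∣_∣ w)) * (χ (isSigned w) * f (s ∷ w))) ∣s∣≡1)))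
    (avoid-units k (λ w → χ (isSigned w) * f (s ∷ w)))

  unit-later : (a : ℤ) → NotUnit a → (s : ℤ) → ∣ s ∣ ≡ 1 → (f : List ℤ → ℕ) (j : ℕ) (w : List ℤ) →
               prefixed a f (ins j s w) ≡ prefixed a (λ v → f (ins (suc j) s v)) w
  unit-later a a≢1 s ∣s∣≡1 f j w = cong (λ b → χ (not b) * f (a ∷ ins j s w)) (begin
    ∣ a ∣ ∈ᵇ map ∣_∣ (ins j s w)                 ≡⟨ cong (∣ a ∣ ∈ᵇ_) (map-ins ∣_∣ j s w) ⟩
    ∣ a ∣ ∈ᵇ ins j ∣ s ∣ (map ∣_∣ w)             ≡⟨ ∈ᵇ-ins (∣ a ∣) j (∣ s ∣) (map ∣_∣ w) ⟩
    (∣ a ∣ ≡ᵇ ∣ s ∣) ∨ (∣ a ∣ ∈ᵇ map ∣_∣ w)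
      ≡⟨ cong (λ m → (∣ a ∣ ≡ᵇ m) ∨ (∣ a ∣ ∈ᵇ map ∣_∣ w)) ∣s∣≡1 ⟩
    (∣ a ∣ ≡ᵇ 1) ∨ (∣ a ∣ ∈ᵇ map ∣_∣ w)
      ≡⟨ cong (_∨ (∣ a ∣ ∈ᵇ map ∣_∣ w)) (≢⇒≡ᵇ-false a≢1) ⟩
    ∣ a ∣ ∈ᵇ map ∣_∣ w                           ∎)
    where open ≡-Reasoning

  remove-units-from : (k : ℕ) (f : List ℤ → ℕ) →
                      sumInj (suc k) (withUnits A) f ≡ sumInj (suc k) A f + insertedUnits k A f
  remove-units-from zero f =
    trans (cong (λ x → 1 * f (-[1+ 0 ] ∷ []) + (1 * f (+ 1 ∷ []) + x)) (sym (+-identityʳ _)))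
          (+-rearrange (1 * f (-[1+ 0 ] ∷ [])) (1 * f (+ 1 ∷ [])) (sumInj 1 A f) 0)
  remove-units-from (suc k) f = begin
    sumInj (suc (suc k)) (withUnits A) f
      ≡⟨ sumInj-cons (suc k) (withUnits A) f ⟩
    first -[1+ 0 ] + (first (+ 1) + sumList (λ a → sumInj (suc k) (withUnits A) (prefixed a f)) A)
      ≡⟨ cong₂ _+_ (unit-first (suc k) -[1+ 0 ] refl f)
           (cong₂ _+_ (unit-first (suc k) (+ 1) refl f) (sumList-cong A (λ a → remove-units-from k (prefixed a f)))) ⟩
    V -[1+ 0 ] + (V (+ 1) + sumList (λ a → sumInj (suc k) A (prefixed a f) + insertedUnits k A (prefixed a f)) A)
      ≡⟨ cong (λ x → V -[1+ 0 ] + (V (+ 1) + x))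
           (trans (sumList-+ (λ a → sumInj (suc k) A (prefixed a f)) (λ a → insertedUnits k A (prefixed a f)) A)
                  (cong₂ _+_ (sym (sumInj-cons (suc k) A f)) later-units)) ⟩
    V -[1+ 0 ] + (V (+ 1) + (sumInj (suc (suc k)) A f + laterInsertions))
      ≡⟨ +-rearrange (V -[1+ 0 ]) (V (+ 1)) (sumInj (suc (suc k)) A f) laterInsertions ⟩
    sumInj (suc (suc k)) A f + insertedUnits (suc k) A f ∎
    where
    open ≡-Reasoning
    first V : ℤ → ℕ
    first s = sumInj (suc k) (withUnits A) (prefixed s f)
    V s = sumInj (suc k) A (λ w → f (s ∷ w))
    laterInsertions : ℕ
    laterInsertions = sumBelow (suc k) (λ j → overUnits (λ s → sumInj (suc k) A (λ w → f (ins (suc j) s w))))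
    collect : (j : ℕ) (s : ℤ) → ∣ s ∣ ≡ 1 →
              sumList (λ a → sumInj k A (λ w → prefixed a f (ins j s w))) A ≡ sumInj (suc k) A (λ w → f (ins (suc j) s w))
    collect j s ∣s∣≡1 = trans
      (sumList-congAll notUnit (λ a a≢1 → sumWords-cong k A (λ w →
        cong (χ (isSigned w) *_) (unit-later a a≢1 s ∣s∣≡1 f j w))))
      (sym (sumInj-cons k A (λ w → f (ins (suc j) s w))))
    later-units : sumList (λ a → insertedUnits k A (prefixed a f)) A ≡ laterInsertions
    later-units = begin
      sumList (λ a → sumBelow (suc k) (λ j → overUnits (λ s → sumInj k A (λ w → prefixed a f (ins j s w))))) A
        ≡⟨ sumList-sumBelow (suc k) (λ a j → overUnits (λ s → sumInj k A (λ w → prefixed a f (ins j s w)))) A ⟩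
      sumBelow (suc k) (λ j → sumList (λ a → overUnits (λ s → sumInj k A (λ w → prefixed a f (ins j s w)))) A)
        ≡⟨ sumBelow-cong (suc k) (λ j _ →
             trans (sumList-overUnits (λ a s → sumInj k A (λ w → prefixed a f (ins j s w))) A)
                   (cong₂ _+_ (collect j -[1+ 0 ] refl) (collect j (+ 1) refl))) ⟩
      laterInsertions ∎

-- The odd extension of g : ℕ → ℕ to ℤ, i.e. oddLift g (-x) = -(g x) (when g 0 ≡ 0).
oddLift : (ℕ → ℕ) → ℤ → ℤ
oddLift g (+ m)    = + (g m)
oddLift g -[1+ m ] = -[1+ (g (suc m) ∸ 1) ]

-- Raising every nonzero absolute value by one makes room for the units ±1.
bump : ℕ → ℕ
bump zero    = zero
bump (suc m) = suc (suc m)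

bumpℤ : ℤ → ℤ
bumpℤ = oddLift bump

∣bumpℤ∣ : (w : List ℤ) → map ∣_∣ (map bumpℤ w) ≡ map bump (map ∣_∣ w)
∣bumpℤ∣ []              = refl
∣bumpℤ∣ (+ m ∷ w)       = cong (bump m ∷_) (∣bumpℤ∣ w)
∣bumpℤ∣ (-[1+ m ] ∷ w)  = cong (suc (suc m) ∷_) (∣bumpℤ∣ w)

-- bump is injective, hence preserves distinctness.
distinct-bump : (xs : List ℕ) → distinct (map bump xs) ≡ distinct xs
distinct-bump []       = refl
distinct-bump (x ∷ xs) = cong₂ (λ b c → not b ∧ c) (∈ᵇ-bump x xs) (distinct-bump xs)
  where
  ≡ᵇ-bump : ∀ a b → (bump a ≡ᵇ bump b) ≡ (a ≡ᵇ b)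
  ≡ᵇ-bump zero    zero    = refl
  ≡ᵇ-bump zero    (suc b) = refl
  ≡ᵇ-bump (suc a) zero    = refl
  ≡ᵇ-bump (suc a) (suc b) = refl
  ∈ᵇ-bump : ∀ a ys → (bump a ∈ᵇ map bump ys) ≡ (a ∈ᵇ ys)
  ∈ᵇ-bump a []       = refl
  ∈ᵇ-bump a (y ∷ ys) = cong₂ _∨_ (≡ᵇ-bump a y) (∈ᵇ-bump a ys)

isSigned-bump : (w : List ℤ) → isSigned (map bumpℤ w) ≡ isSigned w
isSigned-bump w = trans (cong distinct (∣bumpℤ∣ w)) (distinct-bump (map ∣_∣ w))

sumInj-bump : (k : ℕ) (A : List ℤ) (f : List ℤ → ℕ) → sumInj k (map bumpℤ A) f ≡ sumInj k A (λ w → f (map bumpℤ w))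
sumInj-bump k A f = trans (sumWords-map k bumpℤ A _)
  (sumWords-cong k A (λ w → cong (λ b → χ b * f (map bumpℤ w)) (isSigned-bump w)))

notUnit-bump : (A : List ℤ) → All NotUnit (map bumpℤ A)
notUnit-bump []               = []
notUnit-bump (+ zero ∷ A)     = (λ ()) ∷ notUnit-bump A
notUnit-bump (+ suc m ∷ A)    = (λ ()) ∷ notUnit-bump A
notUnit-bump (-[1+ m ] ∷ A)   = (λ ()) ∷ notUnit-bump A

alphabet-suc : (n : ℕ) → alphabet (suc n) ↭ withUnits (map bumpℤ (alphabet n))
alphabet-suc n = subst (λ A → alphabet (suc n) ↭ withUnits A) (sym bumped)
  (prep -[1+ 0 ] (Perm.shift (+ 1) (half neg) (half pos)))
  where
  neg pos : ℕ → ℤ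
  neg k = - (+ suc k)
  pos k = + suc k
  half : (ℕ → ℤ) → List ℤ
  half h = map h (applyUpTo suc n)
  -- h is neg or pos, for which bumpℤ ∘ h and h ∘ suc agree definitionally
  bumped-half : ∀ h → bumpℤ ∘ h ≡ h ∘ suc → map bumpℤ (map h (upTo n)) ≡ half h
  bumped-half h bump-h = begin
    map bumpℤ (map h (upTo n))   ≡⟨ cong (map bumpℤ) (map-applyUpTo id h n) ⟩
    map bumpℤ (applyUpTo h n)    ≡⟨ map-applyUpTo h bumpℤ n ⟩
    applyUpTo (bumpℤ ∘ h) n      ≡⟨ cong (λ g → applyUpTo g n) bump-h ⟩
    applyUpTo (h ∘ suc) n        ≡⟨ sym (map-applyUpTo suc h n) ⟩
    half h                       ∎
    where open ≡-Reasoning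
  bumped : map bumpℤ (alphabet n) ≡ half neg ++ half pos
  bumped = trans (map-++ bumpℤ (map neg (upTo n)) (map pos (upTo n)))
                 (cong₂ _++_ (bumped-half neg refl) (bumped-half pos refl))

inserted : ℕ → ℤ → (List ℤ → ℕ) → List ℤ → ℕ
inserted j s f u = f (ins j s (map bumpℤ u))

remove-units : (k n : ℕ) (f : List ℤ → ℕ) →
  sumInj (suc k) (alphabet (suc n)) f ≡
  sumInj (suc k) (alphabet n) (λ w → f (map bumpℤ w)) +
  sumBelow (suc k) (λ j → overUnits (λ s → sumInj k (alphabet n) (inserted j s f)))
remove-units k n f = begin
  sumInj (suc k) (alphabet (suc n)) f
    ≡⟨ sumWords-↭ (suc k) (λ w → χ (isSigned w) * f w) (alphabet-suc n) ⟩
  sumInj (suc k) (withUnits A) f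
    ≡⟨ remove-units-from A (notUnit-bump (alphabet n)) k f ⟩
  sumInj (suc k) A f + insertedUnits k A f
    ≡⟨ cong₂ _+_ (sumInj-bump (suc k) (alphabet n) f)
         (sumBelow-cong (suc k) (λ j _ → cong₂ _+_ (sumInj-bump k (alphabet n) (λ w → f (ins j -[1+ 0 ] w)))
                                                  (sumInj-bump k (alphabet n) (λ w → f (ins j (+ 1) w))))) ⟩
  sumInj (suc k) (alphabet n) (λ w → f (map bumpℤ w)) +
  sumBelow (suc k) (λ j → overUnits (λ s → sumInj k (alphabet n) (inserted j s f))) ∎
  where
  open ≡-Reasoning
  A = map bumpℤ (alphabet n)

pigeonhole : (n k : ℕ) (f : List ℤ → ℕ) → n < k → sumInj k (alphabet n) f ≡ 0
pigeonhole zero    (suc k) f _         = refl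
pigeonhole (suc n) (suc k) f (s≤s n<k) = begin
  sumInj (suc k) (alphabet (suc n)) f
    ≡⟨ remove-units k n f ⟩
  sumInj (suc k) (alphabet n) (λ w → f (map bumpℤ w)) +
  sumBelow (suc k) (λ j → overUnits (λ s → sumInj k (alphabet n) (inserted j s f)))
    ≡⟨ cong₂ _+_ (pigeonhole n (suc k) (λ w → f (map bumpℤ w)) (m<n⇒m<1+n n<k))
         (trans (sumBelow-cong (suc k) (λ j _ → cong₂ _+_ (pigeonhole n k (inserted j -[1+ 0 ] f) n<k)
                                                          (pigeonhole n k (inserted j (+ 1) f) n<k)))
                (sumBelow-zero (suc k))) ⟩
  0 ∎
  where open ≡-Reasoning

unitAt : (List ℤ → ℕ) → ℕ → ℕ → ℕ
unitAt f t j = overUnits (λ s → sumB t (inserted j s f))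

-- Every signed permutation of length k+1 arises exactly once by bumping a signed permutation
-- of length k and inserting a unit s at a position j ≤ k.
insert-unit : (k : ℕ) (f : List ℤ → ℕ) → sumB (suc k) f ≡ sumBelow (suc k) (unitAt f k)
insert-unit k f = trans (remove-units k k f)
  (cong (_+ sumBelow (suc k) (unitAt f k)) (pigeonhole k (suc k) (λ w → f (map bumpℤ w)) (n<1+n k)))

sumInj-insertions : (L k : ℕ) (A : List ℤ) (G : ℕ → ℤ → List ℤ → ℕ) →
  sumBelow L (λ j → overUnits (λ s → sumInj k A (G j s))) ≡ sumInj k A (λ w → sumBelow L (λ j → overUnits (λ s → G j s w)))
sumInj-insertions zero    k A G = sym (sumInj-* k A 0 (λ _ → 0))
sumInj-insertions (suc L) k A G = sym (begin
  sumInj k A (λ w → overUnits (λ s → G 0 s w) + rest w)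
    ≡⟨ sumInj-+ k A (λ w → overUnits (λ s → G 0 s w)) rest ⟩
  sumInj k A (λ w → overUnits (λ s → G 0 s w)) + sumInj k A rest
    ≡⟨ cong₂ _+_ (sumInj-+ k A (G 0 -[1+ 0 ]) (G 0 (+ 1))) (sym (sumInj-insertions L k A (G ∘ suc))) ⟩
  overUnits (λ s → sumInj k A (G 0 s)) + sumBelow L (λ j → overUnits (λ s → sumInj k A (G (suc j) s))) ∎)
  where
  open ≡-Reasoning
  rest : List ℤ → ℕ
  rest w = sumBelow L (λ j → overUnits (λ s → G (suc j) s w))

insert-unit-inside : (k : ℕ) (f : List ℤ → ℕ) →
  sumB (suc k) f ≡ sumB k (λ w → sumBelow (suc k) (λ j → overUnits (λ s → inserted j s f w)))
insert-unit-inside k f = trans (insert-unit k f) (sumInj-insertions (suc k) k (alphabet k) (λ j s → inserted j s f))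

-- (3) Weights that only depend on the relative order of the letters.

StrictlyIncreasing : (ℕ → ℕ) → Set
StrictlyIncreasing g = ∀ {a b} → a < b → g a < g b

-- Q only depends on the relative order of the letters: it is invariant under the odd
-- extensions of the strictly increasing maps g : ℕ → ℕ with g 0 ≡ 0.
OrderInvariant : (List ℤ → ℕ) → Set
OrderInvariant Q = ∀ g → StrictlyIncreasing g → g 0 ≡ 0 → ∀ w → Q (map (oddLift g) w) ≡ Q w

bump-increasing : StrictlyIncreasing bump
bump-increasing {zero}  {suc b} _         = s≤s z≤n
bump-increasing {suc a} {suc b} (s≤s a<b) = s≤s (s≤s a<b)

invariant-bump : {Q : List ℤ → ℕ} → OrderInvariant Q → ∀ w → Q (map bumpℤ w) ≡ Q w
invariant-bump iQ = iQ bump bump-increasing refl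

increasing-positive : {g : ℕ → ℕ} → StrictlyIncreasing g → g 0 ≡ 0 → ∀ m → 0 < g (suc m)
increasing-positive {g} g↑ g0 m = subst (_< g (suc m)) g0 (g↑ (s≤s z≤n))

-- The map that fixes 0 and 1 and acts like g on the bumped values {2, 3, …}.
fixingOne : (ℕ → ℕ) → ℕ → ℕ
fixingOne g zero    = zero
fixingOne g (suc x) = suc (g x)

fixingOne-increasing : (g : ℕ → ℕ) → StrictlyIncreasing g → StrictlyIncreasing (fixingOne g)
fixingOne-increasing g g↑ {zero}  {suc b} _         = s≤s z≤n
fixingOne-increasing g g↑ {suc a} {suc b} (s≤s a<b) = s≤s (g↑ a<b)

fixingOne-bump : (g : ℕ → ℕ) → StrictlyIncreasing g → g 0 ≡ 0 →
                 ∀ z → oddLift (fixingOne g) (bumpℤ z) ≡ bumpℤ (oddLift g z)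
fixingOne-bump g g↑ g0 (+ zero)  = cong (λ x → + bump x) (sym g0)
fixingOne-bump g g↑ g0 (+ suc m) = cong +_ (sym (bump-positive (g (suc m)) (increasing-positive g↑ g0 m)))
  where
  bump-positive : ∀ x → 0 < x → bump x ≡ suc x
  bump-positive (suc x) _ = refl
fixingOne-bump g g↑ g0 -[1+ m ]  = cong -[1+_] (sym (m+[n∸m]≡n (increasing-positive g↑ g0 m)))

unit-fixed : (g : ℕ → ℕ) → g 0 ≡ 0 → (s : ℤ) → ∣ s ∣ ≡ 1 → oddLift (fixingOne g) s ≡ s
unit-fixed g g0 (+ suc zero) _  = cong (λ x → + suc x) g0
unit-fixed g g0 -[1+ zero ]  _  = cong -[1+_] g0

-- Inserting a unit into the bumped word preserves order invariance: order embeddings of the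
-- bumped word fixing the units are those coming from order embeddings of the word.
inserted-invariant : {Q : List ℤ → ℕ} → OrderInvariant Q → (j : ℕ) (s : ℤ) → ∣ s ∣ ≡ 1 →
                     OrderInvariant (inserted j s Q)
inserted-invariant {Q} iQ j s ∣s∣≡1 g g↑ g0 w = begin
  Q (ins j s (map bumpℤ (map (oddLift g) w)))
    ≡⟨ cong (λ u → Q (ins j s u)) (sym commute) ⟩
  Q (ins j s (map lift⁺ (map bumpℤ w)))
    ≡⟨ cong (λ t → Q (ins j t (map lift⁺ (map bumpℤ w)))) (sym (unit-fixed g g0 s ∣s∣≡1)) ⟩
  Q (ins j (lift⁺ s) (map lift⁺ (map bumpℤ w)))
    ≡⟨ cong Q (sym (map-ins lift⁺ j s (map bumpℤ w))) ⟩
  Q (map lift⁺ (ins j s (map bumpℤ w)))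
    ≡⟨ iQ (fixingOne g) (fixingOne-increasing g g↑) refl (ins j s (map bumpℤ w)) ⟩
  Q (ins j s (map bumpℤ w)) ∎
  where
  open ≡-Reasoning
  lift⁺ : ℤ → ℤ
  lift⁺ = oddLift (fixingOne g)
  commute : map lift⁺ (map bumpℤ w) ≡ map bumpℤ (map (oddLift g) w)
  commute = trans (sym (map-∘ w)) (trans (map-cong (fixingOne-bump g g↑ g0) w) (map-∘ w))

take-ins-before : {A : Set} (j k : ℕ) (x : A) (u : List A) → j ≤ k → take (suc k) (ins j x u) ≡ ins j x (take k u)
take-ins-before zero    k       x u       _         = refl
take-ins-before (suc j) (suc k) x []      _         = refl
take-ins-before (suc j) (suc k) x (a ∷ u) (s≤s j≤k) = cong (a ∷_) (take-ins-before j k x u j≤k)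

drop-ins-before : {A : Set} (j k : ℕ) (x : A) (u : List A) → j ≤ k → drop (suc k) (ins j x u) ≡ drop k u
drop-ins-before zero    k       x u       _         = refl
drop-ins-before (suc j) (suc k) x []      _         = refl
drop-ins-before (suc j) (suc k) x (a ∷ u) (s≤s j≤k) = drop-ins-before j k x u j≤k

take-ins-after : {A : Set} (k j : ℕ) (x : A) (u : List A) → k ≤ length u → take k (ins (k + j) x u) ≡ take k u
take-ins-after zero    j x u       _        = refl
take-ins-after (suc k) j x (a ∷ u) (s≤s k≤) = cong (a ∷_) (take-ins-after k j x u k≤)

drop-ins-after : {A : Set} (k j : ℕ) (x : A) (u : List A) → k ≤ length u → drop k (ins (k + j) x u) ≡ ins j x (drop k u)
drop-ins-after zero    j x u       _        = refl
drop-ins-after (suc k) j x (a ∷ u) (s≤s k≤) = drop-ins-after k j x u k≤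

-- The number of ways to interleave a word of length k with a word of length m.
choose : ℕ → ℕ → ℕ
choose zero    m       = 1
choose (suc k) zero    = 1
choose (suc k) (suc m) = choose k (suc m) + choose (suc k) m

choose-C : ∀ k m → choose k m ≡ (k + m) C k
choose-C zero    m       = refl
choose-C (suc k) zero    = sym (trans (cong (_C suc k) (+-identityʳ (suc k))) (nCn≡1 (suc k)))
choose-C (suc k) (suc m) = begin
  choose k (suc m) + choose (suc k) m          ≡⟨ cong₂ _+_ (choose-C k (suc m)) (choose-C (suc k) m) ⟩
  (k + suc m) C k + (suc k + m) C suc k        ≡⟨ cong (λ n → (k + suc m) C k + n C suc k) (sym (+-suc k m)) ⟩
  (k + suc m) C k + (k + suc m) C suc k        ≡⟨ nCk+nC[k+1]≡[n+1]C[k+1] (k + suc m) k ⟩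
  (suc k + suc m) C suc k                      ∎
  where open ≡-Reasoning

choose-k0 : ∀ k → choose k 0 ≡ 1
choose-k0 zero    = refl
choose-k0 (suc k) = refl

cut : ℕ → (List ℤ → ℕ) → (List ℤ → ℕ) → List ℤ → ℕ
cut k P V w = P (take k w) * V (drop k w)

sum-insertions : (L c y : ℕ) (x : ℕ → ℤ → ℕ) →
  sumBelow L (λ j → overUnits (λ s → (c * y) * x j s)) ≡ (c * y) * sumBelow L (λ j → overUnits (x j))
sum-insertions L c y x = trans
  (sumBelow-cong L (λ j _ → sym (*-distribˡ-+ (c * y) (x j -[1+ 0 ]) (x j (+ 1)))))
  (sumBelow-* L (c * y) (λ j → overUnits (x j)))

module _ (P V : List ℤ → ℕ) (invP : OrderInvariant P) (invV : OrderInvariant V) where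

  left-insertions : (k m c : ℕ) →
    (∀ P' → OrderInvariant P' → sumB (k + m) (cut k P' V) ≡ c * (sumB k P' * sumB m V)) →
    sumBelow (suc k) (unitAt (cut (suc k) P V) (k + m)) ≡ c * (sumB (suc k) P * sumB m V)
  left-insertions k m c hyp = begin
    sumBelow (suc k) (λ j → overUnits (λ s → sumB (k + m) (inserted j s (cut (suc k) P V))))
      ≡⟨ sumBelow-cong (suc k) (λ { j (s≤s j≤k) → cong₂ _+_ (term j j≤k -[1+ 0 ] refl) (term j j≤k (+ 1) refl) }) ⟩
    sumBelow (suc k) (λ j → overUnits (λ s → (c * sumB m V) * sumB k (inserted j s P)))
      ≡⟨ sum-insertions (suc k) c (sumB m V) (λ j s → sumB k (inserted j s P)) ⟩
    (c * sumB m V) * sumBelow (suc k) (λ j → overUnits (λ s → sumB k (inserted j s P)))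
      ≡⟨ cong ((c * sumB m V) *_) (sym (insert-unit k P)) ⟩
    (c * sumB m V) * sumB (suc k) P
      ≡⟨ reorder c (sumB m V) (sumB (suc k) P) ⟩
    c * (sumB (suc k) P * sumB m V) ∎
    where
    open ≡-Reasoning
    reorder : ∀ c y x → (c * y) * x ≡ c * (x * y)
    reorder = solve-∀
    term : (j : ℕ) → j ≤ k → (s : ℤ) → ∣ s ∣ ≡ 1 →
           sumB (k + m) (inserted j s (cut (suc k) P V)) ≡ (c * sumB m V) * sumB k (inserted j s P)
    term j j≤k s unit = begin
      sumB (k + m) (inserted j s (cut (suc k) P V))
        ≡⟨ sumInj-cong (k + m) (alphabet (k + m)) (λ w _ _ → cong₂ _*_
             (cong P (trans (take-ins-before j k s (map bumpℤ w) j≤k) (cong (ins j s) (take-map k w))))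
             (trans (cong V (trans (drop-ins-before j k s (map bumpℤ w) j≤k) (drop-map k w)))
                    (invariant-bump invV (drop k w)))) ⟩
      sumB (k + m) (cut k (inserted j s P) V)
        ≡⟨ hyp (inserted j s P) (inserted-invariant invP j s unit) ⟩
      c * (sumB k (inserted j s P) * sumB m V)
        ≡⟨ sym (reorder c (sumB m V) (sumB k (inserted j s P))) ⟩
      (c * sumB m V) * sumB k (inserted j s P) ∎

  right-insertions : (k m c : ℕ) →
    (∀ V' → OrderInvariant V' → sumB (k + m) (cut k P V') ≡ c * (sumB k P * sumB m V')) →
    sumBelow (suc m) (λ j → unitAt (cut k P V) (k + m) (k + j)) ≡ c * (sumB k P * sumB (suc m) V)
  right-insertions k m c hyp = begin
    sumBelow (suc m) (λ j → overUnits (λ s → sumB (k + m) (inserted (k + j) s (cut k P V))))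
      ≡⟨ sumBelow-cong (suc m) (λ j _ → cong₂ _+_ (term j -[1+ 0 ] refl) (term j (+ 1) refl)) ⟩
    sumBelow (suc m) (λ j → overUnits (λ s → (c * sumB k P) * sumB m (inserted j s V)))
      ≡⟨ sum-insertions (suc m) c (sumB k P) (λ j s → sumB m (inserted j s V)) ⟩
    (c * sumB k P) * sumBelow (suc m) (λ j → overUnits (λ s → sumB m (inserted j s V)))
      ≡⟨ cong ((c * sumB k P) *_) (sym (insert-unit m V)) ⟩
    (c * sumB k P) * sumB (suc m) V
      ≡⟨ *-assoc c (sumB k P) (sumB (suc m) V) ⟩
    c * (sumB k P * sumB (suc m) V) ∎
    where
    open ≡-Reasoning
    k≤ : ∀ w → length w ≡ k + m → k ≤ length (map bumpℤ w)
    k≤ w len = subst (k ≤_) (sym (trans (length-map bumpℤ w) len)) (m≤m+n k m)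
    term : (j : ℕ) (s : ℤ) → ∣ s ∣ ≡ 1 →
           sumB (k + m) (inserted (k + j) s (cut k P V)) ≡ (c * sumB k P) * sumB m (inserted j s V)
    term j s unit = begin
      sumB (k + m) (inserted (k + j) s (cut k P V))
        ≡⟨ sumInj-cong (k + m) (alphabet (k + m)) (λ w _ len → cong₂ _*_
             (trans (cong P (trans (take-ins-after k j s (map bumpℤ w) (k≤ w len)) (take-map k w)))
                    (invariant-bump invP (take k w)))
             (cong V (trans (drop-ins-after k j s (map bumpℤ w) (k≤ w len)) (cong (ins j s) (drop-map k w))))) ⟩
      sumB (k + m) (cut k P (inserted j s V))
        ≡⟨ hyp (inserted j s V) (inserted-invariant invV j s unit) ⟩
      c * (sumB k P * sumB m (inserted j s V))
        ≡⟨ sym (*-assoc c (sumB k P) (sumB m (inserted j s V))) ⟩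
      (c * sumB k P) * sumB m (inserted j s V) ∎

-- For order-invariant P and V, the sum over B_{k+m} of P(first k letters) · V(last m letters)
-- factorises: choose which absolute values go to the front, then standardise both parts.
product-formula : (k m : ℕ) (P V : List ℤ → ℕ) → OrderInvariant P → OrderInvariant V →
                  sumB (k + m) (cut k P V) ≡ choose k m * (sumB k P * sumB m V)
product-formula zero    zero    P V invP invV =
  cong (1 *_) (sym (cong₂ _*_ (*-identityˡ (P [])) (*-identityˡ (V []))))
product-formula zero    (suc m) P V invP invV =
  trans (insert-unit m (cut 0 P V))
        (right-insertions P V invP invV 0 m 1 (λ V' invV' → product-formula 0 m P V' invP invV'))
product-formula (suc k) zero    P V invP invV = begin
  sumB (suc k + 0) F                              ≡⟨ insert-unit (k + 0) F ⟩
  sumBelow (suc k + 0) (unitAt F (k + 0))         ≡⟨ sumBelow-split (suc k) 0 (unitAt F (k + 0)) ⟩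
  sumBelow (suc k) (unitAt F (k + 0)) + 0         ≡⟨ +-identityʳ _ ⟩
  sumBelow (suc k) (unitAt F (k + 0))
    ≡⟨ left-insertions P V invP invV k 0 (choose k 0) (λ P' invP' → product-formula k 0 P' V invP' invV) ⟩
  choose k 0 * Q                                  ≡⟨ cong (_* Q) (choose-k0 k) ⟩
  choose (suc k) 0 * Q                            ∎
  where
  open ≡-Reasoning
  F = cut (suc k) P V
  Q = sumB (suc k) P * sumB 0 V
product-formula (suc k) (suc m) P V invP invV = begin
  sumB (suc k + suc m) F
    ≡⟨ insert-unit (k + suc m) F ⟩
  sumBelow (suc k + suc m) (unitAt F (k + suc m))
    ≡⟨ sumBelow-split (suc k) (suc m) (unitAt F (k + suc m)) ⟩
  sumBelow (suc k) (unitAt F (k + suc m)) + sumBelow (suc m) (λ j → unitAt F (k + suc m) (suc k + j))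
    ≡⟨ cong₂ _+_ (left-insertions P V invP invV k (suc m) (choose k (suc m))
                   (λ P' invP' → product-formula k (suc m) P' V invP' invV))
                 (trans (cong (λ t → sumBelow (suc m) (λ j → unitAt F t (suc k + j))) (+-suc k m))
                        (right-insertions P V invP invV (suc k) m (choose (suc k) m)
                          (λ V' invV' → product-formula (suc k) m P V' invP invV'))) ⟩
  choose k (suc m) * Q + choose (suc k) m * Q
    ≡⟨ sym (*-distribʳ-+ Q (choose k (suc m)) (choose (suc k) m)) ⟩
  choose (suc k) (suc m) * Q ∎
  where
  open ≡-Reasoning
  F = cut (suc k) P V
  Q = sumB (suc k) P * sumB (suc m) V

-- (4) Peak-free signed permutations.  First, the Boolean comparison of integers used for peaks.

lt : ℤ → ℤ → Bool
lt a b = does (a <? b)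

data Opposite : Bool → Bool → Set where
  forwards  : Opposite true false
  backwards : Opposite false true

opposite : (a b : ℤ) → a ≢ b → Opposite (lt a b) (lt b a)
opposite a b a≢b with <-cmp a b
... | tri< a<b _ _ = subst₂ Opposite (sym (dec-true (a <? b) a<b)) (sym (dec-false (b <? a) (<-asym a<b))) forwards
... | tri≈ _ a≡b _ = ⊥-elim (a≢b a≡b)
... | tri> _ _ b<a = subst₂ Opposite (sym (dec-false (a <? b) (<-asym b<a))) (sym (dec-true (b <? a) b<a)) backwards

lt-trans : ∀ a b c → lt a b ≡ true → lt b c ≡ true → lt a c ≡ true
lt-trans a b c ab bc with a <? b | b <? c
lt-trans a b c _  _  | yes a<b | yes b<c = dec-true (a <? c) (<-trans a<b b<c)
lt-trans a b c () _  | no _    | _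
lt-trans a b c _  () | yes _   | no _

lt-asym : ∀ a b → lt a b ≡ true → lt b a ≡ false
lt-asym a b ab with a <? b
lt-asym a b _  | yes a<b = dec-false (b <? a) (<-asym a<b)
lt-asym a b () | no _

false≢true : false ≢ true
false≢true ()

∧-true : ∀ a b → (a ∧ b) ≡ true → a ≡ true × b ≡ true
∧-true true true _ = refl , refl

-- Peak-free words with distinct letters are valleys.

ascending : ℤ → List ℤ → Bool
ascending b []      = true
ascending b (a ∷ w) = lt b a ∧ ascending a w

valley : ℤ → List ℤ → Bool
valley u []      = true
valley u (a ∷ w) = if lt a u then valley a w else ascending u (a ∷ w)

peakFree : List ℤ → Bool
peakFree (a ∷ b ∷ c ∷ r) = not (lt a b ∧ lt c b) ∧ peakFree (b ∷ c ∷ r)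
peakFree _               = true

noPeaks : List ℤ → ℕ
noPeaks w = χ (peakFree w)

peakFree-valley : (u : ℤ) (w : List ℤ) → Unique (u ∷ w) → peakFree (u ∷ w) ≡ valley u w
peakFree-valley u []          _                            = refl
peakFree-valley u (a ∷ [])    ((u≢a ∷ _) ∷ _)              = last-pair (opposite a u (≢-sym u≢a))
  where
  last-pair : ∀ {au ua} → Opposite au ua → true ≡ (if au then true else (ua ∧ true))
  last-pair forwards  = refl
  last-pair backwards = refl
peakFree-valley u (a ∷ b ∷ r) ((u≢a ∷ _) ∷ distinct-abr@((a≢b ∷ _) ∷ _)) =
  trans (cong (not (lt u a ∧ lt b a) ∧_) (peakFree-valley a (b ∷ r) distinct-abr))
        (first-triple (opposite u a u≢a) (opposite a b a≢b))
  where
  -- the triple u, a, b is no peak iff u ∷ a ∷ b ∷ r still descends or ascends correctly at a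
  first-triple : ∀ {ua au ab ba} → Opposite ua au → Opposite ab ba →
    (not (ua ∧ ba) ∧ (if ba then valley b r else (ab ∧ ascending b r))) ≡
    (if au then (if ba then valley b r else (ab ∧ ascending b r)) else (ua ∧ (ab ∧ ascending b r)))
  first-triple forwards  forwards  = refl
  first-triple forwards  backwards = refl
  first-triple backwards forwards  = refl
  first-triple backwards backwards = refl

ins-ascending : (b x : ℤ) (w : List ℤ) → All (x ≢_) w →
  sumBelow (suc (length w)) (λ j → χ (ascending b (ins j x w))) ≡ χ (lt b x) * χ (ascending b w)
ins-ascending b x []      []          = single (lt b x)
  where
  single : ∀ c → χ (c ∧ true) + 0 ≡ χ c * 1
  single true  = refl
  single false = refl
ins-ascending b x (a ∷ w) (x≢a ∷ x∉w) =
  trans (cong (_+_ (χ (ascending b (x ∷ a ∷ w)))) later)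
        (combine (opposite x a x≢a) (lt-trans b x a) (lt-trans b a x))
  where
  A = ascending a w
  later : sumBelow (suc (length w)) (λ j → χ (lt b a ∧ ascending a (ins j x w))) ≡ χ (lt b a) * (χ (lt a x) * χ A)
  later = begin
    sumBelow (suc (length w)) (λ j → χ (lt b a ∧ ascending a (ins j x w)))
      ≡⟨ sumBelow-cong (suc (length w)) (λ j _ → χ-∧ (lt b a) (ascending a (ins j x w))) ⟩
    sumBelow (suc (length w)) (λ j → χ (lt b a) * χ (ascending a (ins j x w)))
      ≡⟨ sumBelow-* (suc (length w)) (χ (lt b a)) (λ j → χ (ascending a (ins j x w))) ⟩
    χ (lt b a) * sumBelow (suc (length w)) (λ j → χ (ascending a (ins j x w)))
      ≡⟨ cong (χ (lt b a) *_) (ins-ascending a x w x∉w) ⟩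
    χ (lt b a) * (χ (lt a x) * χ A) ∎
    where open ≡-Reasoning
  -- x goes in front of a iff x < a, and behind a iff a < x
  combine : ∀ {bx xa ax ba} → Opposite xa ax →
    (bx ≡ true → xa ≡ true → ba ≡ true) → (ba ≡ true → ax ≡ true → bx ≡ true) →
    χ (bx ∧ (xa ∧ A)) + χ ba * (χ ax * χ A) ≡ χ bx * χ (ba ∧ A)
  combine {true}  {ba = true}  forwards  _   _   = refl
  combine {true}  {ba = false} forwards  bxa _   = ⊥-elim (false≢true (bxa refl refl))
  combine {false} {ba = ba}    forwards  _   _   = *-zeroʳ (χ ba)
  combine {true}  {ba = true}  backwards _   _   = +-identityʳ _
  combine {false} {ba = true}  backwards _   bax = ⊥-elim (false≢true (bax refl refl))
  combine {true}  {ba = false} backwards _   _   = refl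
  combine {false} {ba = false} backwards _   _   = refl

-- The step of ins-valley-tail for u ∷ a ∷ v, by cases on the relative order of u, the new letter x
-- and a.  Here V and A say whether a ∷ v is a valley resp. increasing, and `rest` counts the
-- insertions of x behind a that keep a ∷ v a valley.
valley-tail-step : ∀ {au ua xu ux xa ax} (V A : Bool) (rest : ℕ) →
  Opposite au ua → Opposite xu ux → Opposite xa ax →
  (au ≡ true → ux ≡ true → ax ≡ true) → (xu ≡ true → ua ≡ true → xa ≡ true) →
  rest + χ (xa ∧ A) ≡ (χ xa + 1) * χ V →
  (χ (if xu then (if ax then V else (xa ∧ A)) else (ux ∧ (xa ∧ A))) + (if au then rest else χ ua * (χ ax * χ A)))
    + χ (xu ∧ (ua ∧ A)) ≡ (χ xu + 1) * χ (if au then V else (ua ∧ A))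
-- a < u and x < u: both counts reduce to the count for the valley a ∷ v
valley-tail-step V A     rest forwards  forwards  forwards  _ _ hyp = trans (+-identityʳ _) (trans (+-comm (χ A) rest) hyp)
valley-tail-step V A     rest forwards  forwards  backwards _ _ hyp =
  trans (+-identityʳ _) (cong (_+_ (χ V)) (trans (sym (+-identityʳ rest)) hyp))
-- a < u < x: x must go into the increasing part behind a
valley-tail-step V A     rest forwards  backwards forwards  aux _ _   = ⊥-elim (false≢true (aux refl refl))
valley-tail-step V A     rest forwards  backwards backwards _   _ hyp = hyp
-- x < u < a: u ∷ a ∷ v must increase, and x goes directly behind u
valley-tail-step V true  rest backwards forwards  forwards  _ _   _ = refl
valley-tail-step V false rest backwards forwards  forwards  _ _   _ = refl
valley-tail-step V A     rest backwards forwards  backwards _ xua _ = ⊥-elim (false≢true (xua refl refl))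
-- u < a and u < x: u ∷ a ∷ v must increase, and x goes to its place in it
valley-tail-step V A     rest backwards backwards forwards  _ _ _ = +-identityʳ _
valley-tail-step V true  rest backwards backwards backwards _ _ _ = refl
valley-tail-step V false rest backwards backwards backwards _ _ _ = refl

-- Inserting x behind the head u of a valley: this succeeds at 1 + [x < u] positions, except that
-- when u ∷ w is increasing and x < u, the position directly behind u is the only one.
ins-valley-tail : (u x : ℤ) (w : List ℤ) → Unique (u ∷ w) → All (x ≢_) (u ∷ w) →
  sumBelow (suc (length w)) (λ j → χ (valley u (ins j x w))) + χ (lt x u ∧ ascending u w) ≡
  (χ (lt x u) + 1) * χ (valley u w)
ins-valley-tail u x [] _ (x≢u ∷ []) = single (opposite x u x≢u)
  where
  single : ∀ {xu ux} → Opposite xu ux → (χ (if xu then true else (ux ∧ true)) + 0) + χ (xu ∧ true) ≡ (χ xu + 1) * 1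
  single forwards  = refl
  single backwards = refl
ins-valley-tail u x (a ∷ v) ((u≢a ∷ _) ∷ distinct-av) (x≢u ∷ x≢a ∷ x∉v) =
  trans (cong (λ t → (χ (valley u (x ∷ a ∷ v)) + t) + χ (lt x u ∧ ascending u (a ∷ v))) tail-sum)
        (valley-tail-step (valley a v) A rest (opposite a u (≢-sym u≢a)) (opposite x u x≢u) (opposite x a x≢a)
                          (lt-trans a u x) (lt-trans x u a) (ins-valley-tail a x v distinct-av (x≢a ∷ x∉v)))
  where
  A = ascending a v
  rest = sumBelow (suc (length v)) (λ j → χ (valley a (ins j x v)))
  -- behind a, the insertions continue the valley from a if a < u, and the increasing run from a otherwise
  tail-sum : sumBelow (suc (length v)) (λ j → χ (valley u (a ∷ ins j x v))) ≡
             (if lt a u then rest else χ (lt u a) * (χ (lt a x) * χ A))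
  tail-sum = trans (branches (lt a u)) (cong (λ t → if lt a u then rest else χ (lt u a) * t) (ins-ascending a x v x∉v))
    where
    branches : ∀ c →
      sumBelow (suc (length v)) (λ j → χ (if c then valley a (ins j x v) else (lt u a ∧ ascending a (ins j x v)))) ≡
               (if c then rest else χ (lt u a) * sumBelow (suc (length v)) (λ j → χ (ascending a (ins j x v))))
    branches true  = refl
    branches false = trans (sumBelow-cong (suc (length v)) (λ j _ → χ-∧ (lt u a) (ascending a (ins j x v))))
                           (sumBelow-* (suc (length v)) (χ (lt u a)) (λ j → χ (ascending a (ins j x v))))

ins-valley : (u x : ℤ) (w : List ℤ) → Unique (u ∷ w) → All (x ≢_) (u ∷ w) →
  χ (valley x (u ∷ w)) + sumBelow (suc (length w)) (λ j → χ (valley u (ins j x w))) ≡ 2 * χ (valley u w)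
ins-valley u x w distinct x∉uw@(x≢u ∷ _) =
  front (opposite x u x≢u) (ins-valley-tail u x w distinct x∉uw)
  where
  V = valley u w
  -- in front of u, x continues the valley if u < x, and starts it if x < u and u ∷ w increases
  front : ∀ {xu ux} {S} → Opposite xu ux → S + χ (xu ∧ ascending u w) ≡ (χ xu + 1) * χ V →
          χ (if ux then V else (xu ∧ ascending u w)) + S ≡ 2 * χ V
  front {S = S} forwards  hyp = trans (+-comm (χ (ascending u w)) S) hyp
  front {S = S} backwards hyp = cong (_+_ (χ V)) (trans (sym (+-identityʳ S)) hyp)

All-ins : {A : Set} {P : A → Set} (j : ℕ) {x : A} {w : List A} → P x → All P w → All P (ins j x w)
All-ins zero    px pw         = px ∷ pw
All-ins (suc j) px []         = px ∷ []
All-ins (suc j) px (pa ∷ pw)  = pa ∷ All-ins j px pw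

Unique-ins : (j : ℕ) {x : ℤ} {w : List ℤ} → All (x ≢_) w → Unique w → Unique (ins j x w)
Unique-ins zero    x∉w                 distinct          = x∉w ∷ distinct
Unique-ins (suc j) []                  []                = [] ∷ []
Unique-ins (suc j) (x≢a ∷ x∉w) (a∉w ∷ distinct) = All-ins j (≢-sym x≢a) a∉w ∷ Unique-ins j x∉w distinct

ins-peakFree : (x u : ℤ) (w : List ℤ) → Unique (u ∷ w) → All (x ≢_) (u ∷ w) →
  sumBelow (suc (length (u ∷ w))) (λ j → χ (peakFree (ins j x (u ∷ w)))) ≡ 2 * χ (peakFree (u ∷ w))
ins-peakFree x u w distinct x∉uw@(_ ∷ x∉w) = begin
  χ (peakFree (x ∷ u ∷ w)) + sumBelow (suc (length w)) (λ j → χ (peakFree (u ∷ ins j x w)))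
    ≡⟨ cong₂ _+_ (cong χ (peakFree-valley x (u ∷ w) (x∉uw ∷ distinct)))
                 (sumBelow-cong (suc (length w)) (λ j _ → cong χ (peakFree-valley u (ins j x w)
                   (Unique-ins (suc j) x∉uw distinct)))) ⟩
  χ (valley x (u ∷ w)) + sumBelow (suc (length w)) (λ j → χ (valley u (ins j x w)))
    ≡⟨ ins-valley u x w distinct x∉uw ⟩
  2 * χ (valley u w)
    ≡⟨ cong (λ b → 2 * χ b) (sym (peakFree-valley u w distinct)) ⟩
  2 * χ (peakFree (u ∷ w)) ∎
  where open ≡-Reasoning

oddLift-< : (g : ℕ → ℕ) → StrictlyIncreasing g → g 0 ≡ 0 → ∀ {a b} → a <ℤ b → oddLift g a <ℤ oddLift g b
oddLift-< g g↑ g0 (-<- {n = n} n<m) = -<- (ℕ.∸-monoˡ-< (g↑ (s≤s n<m)) (increasing-positive g↑ g0 n))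
oddLift-< g g↑ g0 -<+               = -<+
oddLift-< g g↑ g0 (+<+ m<n)         = +<+ (g↑ m<n)

lt-oddLift : (g : ℕ → ℕ) → StrictlyIncreasing g → g 0 ≡ 0 → ∀ a b → lt (oddLift g a) (oddLift g b) ≡ lt a b
lt-oddLift g g↑ g0 a b with <-cmp a b
... | tri< a<b _ _ = trans (dec-true (oddLift g a <? oddLift g b) (oddLift-< g g↑ g0 a<b)) (sym (dec-true (a <? b) a<b))
... | tri≈ _ refl _ = trans (dec-false (oddLift g a <? oddLift g a) (<-irrefl refl)) (sym (dec-false (a <? a) (<-irrefl refl)))
... | tri> _ _ b<a = trans (dec-false (oddLift g a <? oddLift g b) (<-asym (oddLift-< g g↑ g0 b<a)))
                          (sym (dec-false (a <? b) (<-asym b<a)))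

peakFree-invariant : OrderInvariant noPeaks
peakFree-invariant g g↑ g0 w = cong χ (preserved w)
  where
  preserved : ∀ w → peakFree (map (oddLift g) w) ≡ peakFree w
  preserved (a ∷ b ∷ c ∷ r) = cong₂ (λ p q → not p ∧ q)
    (cong₂ _∧_ (lt-oddLift g g↑ g0 a b) (lt-oddLift g g↑ g0 c b)) (preserved (b ∷ c ∷ r))
  preserved []              = refl
  preserved (a ∷ [])        = refl
  preserved (a ∷ b ∷ [])    = refl

distinct⇒Unique : (xs : List ℕ) → distinct xs ≡ true → Unique xs
distinct⇒Unique []       _ = []
distinct⇒Unique (x ∷ xs) d with x ∈ᵇ xs in x∈xs
... | false = fresh xs x∈xs ∷ distinct⇒Unique xs d
  where
  fresh : ∀ ys → (x ∈ᵇ ys) ≡ false → All (x ≢_) ys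
  fresh []       _  = []
  fresh (y ∷ ys) ∉ with x ≡ᵇ y in x≡ᵇy
  ... | false = (λ x≡y → subst T x≡ᵇy (ℕ.≡⇒≡ᵇ x y x≡y)) ∷ fresh ys ∉

isSigned⇒Unique : (w : List ℤ) → isSigned w ≡ true → Unique w
isSigned⇒Unique w signed = Unique.map⁻ (distinct⇒Unique (map ∣_∣ w) signed)

unit∉bumped : (s : ℤ) → ∣ s ∣ ≡ 1 → (w : List ℤ) → All (s ≢_) (map bumpℤ w)
unit∉bumped s unit w = All.map (λ a≢1 s≡a → a≢1 (trans (cong ∣_∣ (sym s≡a)) unit)) (notUnit-bump w)

-- Each peak-free signed permutation of length m+1 yields exactly four peak-free ones of length
-- m+2 by raising its absolute values and inserting a unit: each unit fits at two positions.
four-insertions : (m : ℕ) (w : List ℤ) → isSigned w ≡ true → length w ≡ suc m →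
  sumBelow (suc (suc m)) (λ j → overUnits (λ s → inserted j s noPeaks w)) ≡ 4 * noPeaks w
four-insertions m (a ∷ v) signed len = begin
  sumBelow (suc (suc m)) (λ j → noPeaks (ins j -[1+ 0 ] u) + noPeaks (ins j (+ 1) u))
    ≡⟨ sumBelow-+ (suc (suc m)) (λ j → noPeaks (ins j -[1+ 0 ] u)) (λ j → noPeaks (ins j (+ 1) u)) ⟩
  sumBelow (suc (suc m)) (λ j → noPeaks (ins j -[1+ 0 ] u)) + sumBelow (suc (suc m)) (λ j → noPeaks (ins j (+ 1) u))
    ≡⟨ cong₂ _+_ (two-positions -[1+ 0 ] refl) (two-positions (+ 1) refl) ⟩
  2 * noPeaks u + 2 * noPeaks u
    ≡⟨ doubled (noPeaks u) ⟩
  4 * noPeaks u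
    ≡⟨ cong (4 *_) (invariant-bump peakFree-invariant (a ∷ v)) ⟩
  4 * noPeaks (a ∷ v) ∎
  where
  open ≡-Reasoning
  u = map bumpℤ (a ∷ v)
  doubled : ∀ y → 2 * y + 2 * y ≡ 4 * y
  doubled = solve-∀
  length-v : length (map bumpℤ v) ≡ m
  length-v = trans (length-map bumpℤ v) (ℕ.suc-injective len)
  two-positions : (s : ℤ) → ∣ s ∣ ≡ 1 → sumBelow (suc (suc m)) (λ j → noPeaks (ins j s u)) ≡ 2 * noPeaks u
  two-positions s unit = trans
    (cong (λ n → sumBelow (suc (suc n)) (λ j → noPeaks (ins j s u))) (sym length-v))
    (ins-peakFree s (bumpℤ a) (map bumpℤ v) (isSigned⇒Unique u (trans (isSigned-bump (a ∷ v)) signed))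
                  (unit∉bumped s unit (a ∷ v)))

peakFree-count : (m : ℕ) → sumB (suc m) noPeaks ≡ 2 ^ (2 * m + 1)
peakFree-count zero    = refl
peakFree-count (suc m) = begin
  sumB (suc (suc m)) noPeaks
    ≡⟨ insert-unit-inside (suc m) noPeaks ⟩
  sumB (suc m) (λ w → sumBelow (suc (suc m)) (λ j → overUnits (λ s → inserted j s noPeaks w)))
    ≡⟨ sumInj-cong (suc m) (alphabet (suc m)) (λ w signed len → four-insertions m w signed len) ⟩
  sumB (suc m) (λ w → 4 * noPeaks w)
    ≡⟨ sumInj-* (suc m) (alphabet (suc m)) 4 noPeaks ⟩
  4 * sumB (suc m) noPeaks
    ≡⟨ cong (4 *_) (peakFree-count m) ⟩
  2 ^ 2 * 2 ^ (2 * m + 1)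
    ≡⟨ sym (trans (cong (2 ^_) (exponent m)) (ℕ.^-distribˡ-+-* 2 2 (2 * m + 1))) ⟩
  2 ^ (2 * suc m + 1) ∎
  where
  open ≡-Reasoning
  exponent : ∀ m → 2 * suc m + 1 ≡ 2 + (2 * m + 1)
  exponent = solve-∀

-- (5) Peaks of a word, of its prefixes and of its suffixes.

peakTriple : List ℤ → Bool
peakTriple (a ∷ b ∷ c ∷ r) = lt a b ∧ lt c b
peakTriple _               = false

-- The letter at offset d+1 of L is larger than both of its neighbours in L.
peakAt : List ℤ → ℕ → Bool
peakAt L       zero    = peakTriple L
peakAt []      (suc d) = false
peakAt (a ∷ L) (suc d) = peakAt L d

peakAt-[] : ∀ d → peakAt [] d ≡ false
peakAt-[] zero    = refl
peakAt-[] (suc d) = refl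

∈ᵇ-if : ∀ x j R h → (x ∈ᵇ (if h then j ∷ R else R)) ≡ ((h ∧ (x ≡ᵇ j)) ∨ (x ∈ᵇ R))
∈ᵇ-if x j R true  = refl
∈ᵇ-if x j R false = refl

∉peaksFrom : (j x : ℕ) (L : List ℤ) → x < j → (x ∈ᵇ peaksFrom j L) ≡ false
∉peaksFrom j x (a ∷ b ∷ c ∷ r) x<j = begin
  x ∈ᵇ peaksFrom j (a ∷ b ∷ c ∷ r)
    ≡⟨ ∈ᵇ-if x j (peaksFrom (suc j) (b ∷ c ∷ r)) (lt a b ∧ lt c b) ⟩
  ((lt a b ∧ lt c b) ∧ (x ≡ᵇ j)) ∨ (x ∈ᵇ peaksFrom (suc j) (b ∷ c ∷ r))
    ≡⟨ cong₂ _∨_ (trans (cong ((lt a b ∧ lt c b) ∧_) (≢⇒≡ᵇ-false (ℕ.<⇒≢ x<j))) (∧-zeroʳ _))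
                 (∉peaksFrom (suc j) x (b ∷ c ∷ r) (m<n⇒m<1+n x<j)) ⟩
  false ∎
  where open ≡-Reasoning
∉peaksFrom j x []            _ = refl
∉peaksFrom j x (a ∷ [])      _ = refl
∉peaksFrom j x (a ∷ b ∷ [])  _ = refl

∈peaksFrom : (j d : ℕ) (L : List ℤ) → ((j + d) ∈ᵇ peaksFrom j L) ≡ peakAt L d
∈peaksFrom j zero (a ∷ b ∷ c ∷ r) = begin
  (j + 0) ∈ᵇ peaksFrom j (a ∷ b ∷ c ∷ r)
    ≡⟨ cong (_∈ᵇ peaksFrom j (a ∷ b ∷ c ∷ r)) (+-identityʳ j) ⟩
  j ∈ᵇ peaksFrom j (a ∷ b ∷ c ∷ r)
    ≡⟨ ∈ᵇ-if j j (peaksFrom (suc j) (b ∷ c ∷ r)) (lt a b ∧ lt c b) ⟩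
  ((lt a b ∧ lt c b) ∧ (j ≡ᵇ j)) ∨ (j ∈ᵇ peaksFrom (suc j) (b ∷ c ∷ r))
    ≡⟨ cong₂ _∨_ (trans (cong ((lt a b ∧ lt c b) ∧_) (≡ᵇ-refl j)) (∧-identityʳ _))
                 (∉peaksFrom (suc j) j (b ∷ c ∷ r) (n<1+n j)) ⟩
  (lt a b ∧ lt c b) ∨ false
    ≡⟨ ∨-identityʳ _ ⟩
  lt a b ∧ lt c b ∎
  where open ≡-Reasoning
∈peaksFrom j (suc d) (a ∷ b ∷ c ∷ r) = begin
  (j + suc d) ∈ᵇ peaksFrom j (a ∷ b ∷ c ∷ r)
    ≡⟨ ∈ᵇ-if (j + suc d) j (peaksFrom (suc j) (b ∷ c ∷ r)) (lt a b ∧ lt c b) ⟩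
  ((lt a b ∧ lt c b) ∧ ((j + suc d) ≡ᵇ j)) ∨ ((j + suc d) ∈ᵇ peaksFrom (suc j) (b ∷ c ∷ r))
    ≡⟨ cong₂ _∨_ (trans (cong ((lt a b ∧ lt c b) ∧_) (≢⇒≡ᵇ-false (ℕ.m+1+n≢m j))) (∧-zeroʳ _))
                 (trans (cong (_∈ᵇ peaksFrom (suc j) (b ∷ c ∷ r)) (+-suc j d)) (∈peaksFrom (suc j) d (b ∷ c ∷ r))) ⟩
  peakAt (b ∷ c ∷ r) d ∎
  where open ≡-Reasoning
∈peaksFrom j d             []           = sym (peakAt-[] d)
∈peaksFrom j zero          (a ∷ [])     = refl
∈peaksFrom j (suc d)       (a ∷ [])     = sym (peakAt-[] d)
∈peaksFrom j zero          (a ∷ b ∷ []) = refl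
∈peaksFrom j (suc zero)    (a ∷ b ∷ []) = refl
∈peaksFrom j (suc (suc d)) (a ∷ b ∷ []) = sym (peakAt-[] d)

isPeak : List ℤ → ℕ → Bool
isPeak π x = x ∈ᵇ peakSet π

isPeak-zero : (π : List ℤ) → isPeak π 0 ≡ false
isPeak-zero π = ∉peaksFrom 1 0 (+ 0 ∷ π) (s≤s z≤n)

isPeak-suc : (π : List ℤ) (d : ℕ) → isPeak π (suc d) ≡ peakAt (+ 0 ∷ π) d
isPeak-suc π d = ∈peaksFrom 1 d (+ 0 ∷ π)

peakAt-adjacent : (L : List ℤ) (d : ℕ) → peakAt L d ≡ true → peakAt L (suc d) ≡ false
peakAt-adjacent (a ∷ b ∷ c ∷ e ∷ r) zero    peak = cong (_∧ lt e c) (lt-asym c b (proj₂ (∧-true (lt a b) (lt c b) peak)))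
peakAt-adjacent (a ∷ b ∷ c ∷ [])    zero    _    = refl
peakAt-adjacent (a ∷ L)             (suc d) peak = peakAt-adjacent L d peak

isPeak-adjacent : (π : List ℤ) (x : ℕ) → isPeak π x ≡ true → isPeak π (suc x) ≡ false
isPeak-adjacent π zero    peak = ⊥-elim (false≢true (trans (sym (isPeak-zero π)) peak))
isPeak-adjacent π (suc d) peak =
  trans (isPeak-suc π (suc d)) (peakAt-adjacent (+ 0 ∷ π) d (trans (sym (isPeak-suc π d)) peak))

peakAt-length : (L : List ℤ) (d : ℕ) → peakAt L d ≡ true → suc (suc (suc d)) ≤ length L
peakAt-length (a ∷ b ∷ c ∷ r) zero    _    = s≤s (s≤s (s≤s z≤n))
peakAt-length (a ∷ L)         (suc d) peak = s≤s (peakAt-length L d peak)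

peakAt-take : (m : ℕ) (L : List ℤ) (d : ℕ) → peakAt (take m L) d ≡ (peakAt L d ∧ (suc (suc d) <ᵇ m))
peakAt-take zero                L               d       = trans (peakAt-[] d) (sym (∧-zeroʳ (peakAt L d)))
peakAt-take (suc m)             []              d       = trans (peakAt-[] d) (cong (_∧ (suc (suc d) <ᵇ suc m)) (sym (peakAt-[] d)))
peakAt-take (suc m)             (a ∷ L)         (suc d) = peakAt-take m L d
peakAt-take (suc zero)          (a ∷ L)         zero    = sym (∧-zeroʳ (peakAt (a ∷ L) 0))
peakAt-take (suc (suc zero))    (a ∷ [])        zero    = refl
peakAt-take (suc (suc zero))    (a ∷ b ∷ L)     zero    = sym (∧-zeroʳ (peakAt (a ∷ b ∷ L) 0))
peakAt-take (suc (suc (suc m))) (a ∷ [])        zero    = refl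
peakAt-take (suc (suc (suc m))) (a ∷ b ∷ [])    zero    = refl
peakAt-take (suc (suc (suc m))) (a ∷ b ∷ c ∷ L) zero    = sym (∧-identityʳ (lt a b ∧ lt c b))

isPeak-take : (k : ℕ) (π : List ℤ) (x : ℕ) → isPeak (take k π) x ≡ (isPeak π x ∧ (x <ᵇ k))
isPeak-take k π zero    = trans (isPeak-zero (take k π)) (cong (_∧ (0 <ᵇ k)) (sym (isPeak-zero π)))
isPeak-take k π (suc d) = begin
  isPeak (take k π) (suc d)                         ≡⟨ isPeak-suc (take k π) d ⟩
  peakAt (take (suc k) (+ 0 ∷ π)) d                 ≡⟨ peakAt-take (suc k) (+ 0 ∷ π) d ⟩
  peakAt (+ 0 ∷ π) d ∧ (suc d <ᵇ k)                 ≡⟨ cong (_∧ (suc d <ᵇ k)) (sym (isPeak-suc π d)) ⟩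
  isPeak π (suc d) ∧ (suc d <ᵇ k)                   ∎
  where open ≡-Reasoning

peakAt-drop : (k : ℕ) (L : List ℤ) (d : ℕ) → peakAt (drop k L) d ≡ peakAt L (k + d)
peakAt-drop zero    L       d = refl
peakAt-drop (suc k) []      d = peakAt-[] d
peakAt-drop (suc k) (a ∷ L) d = peakAt-drop k L d

peakFree⇒ : (β : List ℤ) → peakFree β ≡ true → ∀ d → peakAt β d ≡ false
peakFree⇒ (a ∷ b ∷ c ∷ r) free zero    = not-true (proj₁ (∧-true (not (lt a b ∧ lt c b)) _ free))
  where
  not-true : ∀ {p} → not p ≡ true → p ≡ false
  not-true {false} _ = refl
peakFree⇒ (a ∷ b ∷ c ∷ r) free (suc d) = peakFree⇒ (b ∷ c ∷ r) (proj₂ (∧-true (not (lt a b ∧ lt c b)) _ free)) d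
peakFree⇒ []              _    d       = peakAt-[] d
peakFree⇒ (a ∷ [])        _    zero    = refl
peakFree⇒ (a ∷ [])        _    (suc d) = peakAt-[] d
peakFree⇒ (a ∷ b ∷ [])    _    zero    = refl
peakFree⇒ (a ∷ b ∷ [])    _    (suc zero)    = refl
peakFree⇒ (a ∷ b ∷ [])    _    (suc (suc d)) = peakAt-[] d

⇒peakFree : (β : List ℤ) → (∀ d → peakAt β d ≡ false) → peakFree β ≡ true
⇒peakFree (a ∷ b ∷ c ∷ r) none = cong₂ (λ p q → not p ∧ q) (none 0) (⇒peakFree (b ∷ c ∷ r) (none ∘ suc))
⇒peakFree []              _    = refl
⇒peakFree (a ∷ [])        _    = refl
⇒peakFree (a ∷ b ∷ [])    _    = refl

∈ᵇ-snoc : (x : ℕ) (S : List ℕ) (y : ℕ) → (x ∈ᵇ (S ++ y ∷ [])) ≡ ((x ∈ᵇ S) ∨ (x ≡ᵇ y))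
∈ᵇ-snoc x []      y = ∨-identityʳ (x ≡ᵇ y)
∈ᵇ-snoc x (s ∷ S) y =
  trans (cong ((x ≡ᵇ s) ∨_) (∈ᵇ-snoc x S y)) (sym (∨-assoc (x ≡ᵇ s) (x ∈ᵇ S) (x ≡ᵇ y)))

∈ᵇ-snoc-last : (S : List ℕ) (i : ℕ) → (i ∈ᵇ (S ++ i ∷ [])) ≡ true
∈ᵇ-snoc-last S i = trans (∈ᵇ-snoc i S i) (trans (cong ((i ∈ᵇ S) ∨_) (≡ᵇ-refl i)) (∨-zeroʳ (i ∈ᵇ S)))

∈ᵇ-snoc-init : (S : List ℕ) (i y : ℕ) → (y ∈ᵇ S) ≡ true → (y ∈ᵇ (S ++ i ∷ [])) ≡ true
∈ᵇ-snoc-init S i y y∈ = trans (∈ᵇ-snoc y S i) (cong (_∨ (y ≡ᵇ i)) y∈)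

Below : List ℕ → ℕ → Set
Below S k = ∀ y → (y ∈ᵇ S) ≡ true → y < k

all-true : (q : ℕ → Bool) (xs : List ℕ) → all q xs ≡ true → ∀ x → (x ∈ᵇ xs) ≡ true → q x ≡ true
all-true q (y ∷ ys) all-q x x∈ with ∧-true (q y) (all q ys) all-q | x ≡ᵇ y in x≡ᵇy
... | qy , _    | true  = subst (λ z → q z ≡ true) (sym (ℕ.≡ᵇ⇒≡ x y (Equivalence.from T-≡ x≡ᵇy))) qy
... | _  , all' | false = all-true q ys all' x x∈

all-intro : (q : ℕ → Bool) (xs : List ℕ) → (∀ x → (x ∈ᵇ xs) ≡ true → q x ≡ true) → all q xs ≡ true
all-intro q []       _   = refl
all-intro q (y ∷ ys) q-∈ = cong₂ _∧_ (q-∈ y (cong (_∨ (y ∈ᵇ ys)) (≡ᵇ-refl y)))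
  (all-intro q ys (λ x x∈ → q-∈ x (trans (cong ((x ≡ᵇ y) ∨_) x∈) (∨-zeroʳ (x ≡ᵇ y)))))

≈ˢ-sound : (L M : List ℕ) → (L ≈ˢ M) ≡ true → ∀ x → (x ∈ᵇ L) ≡ (x ∈ᵇ M)
≈ˢ-sound L M L≈M x with ∧-true (all (_∈ᵇ M) L) (all (_∈ᵇ L) M) L≈M | x ∈ᵇ L in x∈L | x ∈ᵇ M in x∈M
... | _      , _      | true  | true  = refl
... | _      , _      | false | false = refl
... | L⊆M   , _      | true  | false = ⊥-elim (false≢true (trans (sym x∈M) (all-true (_∈ᵇ M) L L⊆M x x∈L)))
... | _      , M⊆L   | false | true  = ⊥-elim (false≢true (trans (sym x∈L) (all-true (_∈ᵇ L) M M⊆L x x∈M)))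

≈ˢ-complete : (L M : List ℕ) → (∀ x → (x ∈ᵇ L) ≡ (x ∈ᵇ M)) → (L ≈ˢ M) ≡ true
≈ˢ-complete L M same = cong₂ _∧_ (all-intro (_∈ᵇ M) L (λ x x∈L → trans (sym (same x)) x∈L))
                                 (all-intro (_∈ᵇ L) M (λ x x∈M → trans (same x) x∈M))

peak-of : (π : List ℤ) (T : List ℕ) (x : ℕ) → (peakSet π ≈ˢ T) ≡ true → (x ∈ᵇ T) ≡ true → isPeak π x ≡ true
peak-of π T x same x∈T = trans (≈ˢ-sound (peakSet π) T same x) x∈T

false-unless : {b : Bool} {P : Set} → (b ≡ true → P) → ¬ P → b ≡ false
false-unless {true}  b⇒P ¬P = ⊥-elim (¬P (b⇒P refl))
false-unless {false} _   _  = refl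

data Position (k : ℕ) : ℕ → Set where
  below : ∀ {x} → x < k → Position k x
  at    : Position k k
  next  : Position k (suc k)
  above : ∀ d → Position k (suc (suc (k + d)))

position : ∀ k x → Position k x
position zero    zero          = at
position zero    (suc zero)    = next
position zero    (suc (suc d)) = above d
position (suc k) zero          = below (s≤s z≤n)
position (suc k) (suc x) with position k x
... | below x<k = below (s≤s x<k)
... | at        = at
... | next      = next
... | above d   = above d

-- Fix a set p of positions (the peaks of a word), a cut k and a set S below k.
module Cut (p : ℕ → Bool) (k : ℕ) (S : List ℕ) (S<k : Below S k) where

  S-above : ∀ x → k ≤ x → (x ∈ᵇ S) ≡ false
  S-above x k≤x with x ∈ᵇ S in x∈S
  ... | true  = ⊥-elim (ℕ.<⇒≱ (S<k x x∈S) k≤x)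
  ... | false = refl

  extend : Bool → Bool → ℕ → Bool
  extend b₀ b₁ x = (x ∈ᵇ S) ∨ ((b₀ ∧ (x ≡ᵇ k)) ∨ (b₁ ∧ (x ≡ᵇ suc k)))

  extend-below : ∀ b₀ b₁ {x} → x < k → extend b₀ b₁ x ≡ (x ∈ᵇ S)
  extend-below b₀ b₁ {x} x<k
    rewrite ≢⇒≡ᵇ-false (ℕ.<⇒≢ x<k) | ≢⇒≡ᵇ-false (ℕ.<⇒≢ (m<n⇒m<1+n x<k)) | ∧-zeroʳ b₀ | ∧-zeroʳ b₁ =
    ∨-identityʳ (x ∈ᵇ S)

  extend-at : ∀ b₀ b₁ → extend b₀ b₁ k ≡ b₀
  extend-at b₀ b₁
    rewrite S-above k ℕ.≤-refl | ≡ᵇ-refl k | ≢⇒≡ᵇ-false (ℕ.<⇒≢ (n<1+n k)) | ∧-identityʳ b₀ | ∧-zeroʳ b₁ =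
    ∨-identityʳ b₀

  extend-next : ∀ b₀ b₁ → extend b₀ b₁ (suc k) ≡ b₁
  extend-next b₀ b₁
    rewrite S-above (suc k) (ℕ.n≤1+n k) | ≢⇒≡ᵇ-false (≢-sym (ℕ.<⇒≢ (n<1+n k))) | ≡ᵇ-refl k
          | ∧-zeroʳ b₀ | ∧-identityʳ b₁ =
    refl

  extend-above : ∀ b₀ b₁ d → extend b₀ b₁ (suc (suc (k + d))) ≡ false
  extend-above b₀ b₁ d
    rewrite S-above (suc (suc (k + d))) (ℕ.m≤n⇒m≤1+n (ℕ.m≤n⇒m≤1+n (m≤m+n k d)))
          | ≢⇒≡ᵇ-false (≢-sym (ℕ.<⇒≢ (m<n⇒m<1+n (s≤s (m≤m+n k d)))))
          | ≢⇒≡ᵇ-false (≢-sym (ℕ.<⇒≢ (s≤s (s≤s (m≤m+n k d)))))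
          | ∧-zeroʳ b₀ | ∧-zeroʳ b₁ = refl

  Fits : Bool → Bool → Set
  Fits b₀ b₁ = ∀ x → p x ≡ extend b₀ b₁ x

  Outside : Set
  Outside = (∀ x → x < k → p x ≡ (x ∈ᵇ S)) × (∀ d → p (suc (suc (k + d))) ≡ false)

  fits⇒ : ∀ {b₀ b₁} → Fits b₀ b₁ → Outside × p k ≡ b₀ × p (suc k) ≡ b₁
  fits⇒ {b₀} {b₁} fits =
    ((λ x x<k → trans (fits x) (extend-below b₀ b₁ x<k)) , (λ d → trans (fits _) (extend-above b₀ b₁ d))) ,
    trans (fits k) (extend-at b₀ b₁) , trans (fits (suc k)) (extend-next b₀ b₁)

  ⇒fits : ∀ {b₀ b₁} → Outside → p k ≡ b₀ → p (suc k) ≡ b₁ → Fits b₀ b₁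
  ⇒fits {b₀} {b₁} (low , high) pk psk x with position k x
  ... | below x<k = trans (low x x<k) (sym (extend-below b₀ b₁ x<k))
  ... | at        = trans pk (sym (extend-at b₀ b₁))
  ... | next      = trans psk (sym (extend-next b₀ b₁))
  ... | above d   = trans (high d) (sym (extend-above b₀ b₁ d))

  fits-only-outside : ∀ {b} b₀ b₁ → (b ≡ true ⇔ Fits b₀ b₁) → ¬ Outside → b ≡ false
  fits-only-outside b₀ b₁ r ¬outside = false-unless (Equivalence.to r) (λ f → ¬outside (proj₁ (fits⇒ {b₀} {b₁} f)))

  fits-only-at : ∀ {b} b₀ b₁ → (b ≡ true ⇔ Fits b₀ b₁) → (p k ≡ b₀ → p (suc k) ≡ b₁ → ⊥) → b ≡ false
  fits-only-at b₀ b₁ r wrong = false-unless (Equivalence.to r) (λ f →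
    let (_ , at-k , at-k+1) = fits⇒ {b₀} {b₁} f in wrong at-k at-k+1)

  fits-if : ∀ {b} b₀ b₁ → (b ≡ true ⇔ Fits b₀ b₁) → Outside → p k ≡ b₀ → p (suc k) ≡ b₁ → b ≡ true
  fits-if b₀ b₁ r outside e₀ e₁ = Equivalence.from r (⇒fits outside e₀ e₁)

  exactly-one : (p k ≡ true → p (suc k) ≡ false) → ∀ {bA bB bC bO} →
    (bA ≡ true ⇔ Fits false true) → (bB ≡ true ⇔ Fits false false) → (bC ≡ true ⇔ Fits true false) →
    (bO ≡ true ⇔ Outside) → χ bA + (χ bB + χ bC) ≡ χ bO
  exactly-one adj {bO = false} rA rB rC rO
    rewrite fits-only-outside false true rA (false≢true ∘ Equivalence.from rO)
          | fits-only-outside false false rB (false≢true ∘ Equivalence.from rO)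
          | fits-only-outside true false rC (false≢true ∘ Equivalence.from rO) = refl
  exactly-one adj {bA} {bB} {bC} {true} rA rB rC rO = by-values (p k) (p (suc k)) refl refl
    where
    outside = Equivalence.to rO refl
    by-values : ∀ v₀ v₁ → p k ≡ v₀ → p (suc k) ≡ v₁ → χ bA + (χ bB + χ bC) ≡ 1
    by-values false true pk psk
      rewrite fits-if false true rA outside pk psk
            | fits-only-at false false rB (λ _ e → false≢true (trans (sym e) psk))
            | fits-only-at true false rC (λ e _ → false≢true (trans (sym pk) e)) = refl
    by-values false false pk psk
      rewrite fits-if false false rB outside pk psk
            | fits-only-at false true rA (λ _ e → false≢true (trans (sym psk) e))
            | fits-only-at true false rC (λ e _ → false≢true (trans (sym pk) e)) = refl
    by-values true false pk psk
      rewrite fits-if true false rC outside pk psk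
            | fits-only-at false true rA (λ e _ → false≢true (trans (sym e) pk))
            | fits-only-at false false rB (λ e _ → false≢true (trans (sym e) pk)) = refl
    by-values true true pk psk = ⊥-elim (false≢true (trans (sym (adj pk)) psk))

prefix-peaks : (S : List ℕ) (k : ℕ) (π : List ℤ) → Below S k →
  (peakSet (take k π) ≈ˢ S) ≡ true ⇔ (∀ x → x < k → isPeak π x ≡ (x ∈ᵇ S))
prefix-peaks S k π S<k = mk⇔
  (λ same x x<k → begin
     isPeak π x                     ≡⟨ sym (∧-identityʳ (isPeak π x)) ⟩
     isPeak π x ∧ true              ≡⟨ cong (isPeak π x ∧_) (sym (Equivalence.to T-≡ (ℕ.<⇒<ᵇ x<k))) ⟩
     isPeak π x ∧ (x <ᵇ k)          ≡⟨ sym (isPeak-take k π x) ⟩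
     isPeak (take k π) x            ≡⟨ ≈ˢ-sound (peakSet (take k π)) S same x ⟩
     x ∈ᵇ S                         ∎)
  (λ low → ≈ˢ-complete (peakSet (take k π)) S (λ x → trans (isPeak-take k π x) (cut-at x (x <ᵇ k) refl low)))
  where
  open ≡-Reasoning
  open Cut (isPeak π) k S S<k using (S-above)
  cut-at : ∀ x b → (x <ᵇ k) ≡ b → (∀ x → x < k → isPeak π x ≡ (x ∈ᵇ S)) → (isPeak π x ∧ b) ≡ (x ∈ᵇ S)
  cut-at x true  x<ᵇk low = trans (∧-identityʳ (isPeak π x)) (low x (ℕ.<ᵇ⇒< x k (Equivalence.from T-≡ x<ᵇk)))
  cut-at x false x≮ᵇk _   = trans (∧-zeroʳ (isPeak π x)) (sym (S-above x (ℕ.≮⇒≥ (λ x<k →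
    false≢true (trans (sym x≮ᵇk) (Equivalence.to T-≡ (ℕ.<⇒<ᵇ x<k)))))))

suffix-peakFree : (k : ℕ) (π : List ℤ) →
  peakFree (drop k π) ≡ true ⇔ (∀ d → isPeak π (suc (suc (k + d))) ≡ false)
suffix-peakFree k π = mk⇔
  (λ free d → trans (shifted d) (peakFree⇒ (drop k π) free d))
  (λ none → ⇒peakFree (drop k π) (λ d → trans (sym (shifted d)) (none d)))
  where
  shifted : ∀ d → isPeak π (suc (suc (k + d))) ≡ peakAt (drop k π) d
  shifted d = trans (isPeak-suc π (suc (k + d))) (sym (peakAt-drop k π d))

hasPeakSet : List ℕ → List ℤ → ℕ
hasPeakSet S u = χ (peakSet u ≈ˢ S)

hasPeakSet-invariant : (S : List ℕ) → OrderInvariant (hasPeakSet S)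
hasPeakSet-invariant S g g↑ g0 u = cong (λ L → χ (L ≈ˢ S)) (begin
  peaksFrom 1 (+ 0 ∷ map (oddLift g) u)          ≡⟨ cong (λ z → peaksFrom 1 (+ z ∷ map (oddLift g) u)) (sym g0) ⟩
  peaksFrom 1 (map (oddLift g) (+ 0 ∷ u))        ≡⟨ preserved 1 (+ 0 ∷ u) ⟩
  peaksFrom 1 (+ 0 ∷ u)                          ∎)
  where
  open ≡-Reasoning
  preserved : ∀ j L → peaksFrom j (map (oddLift g) L) ≡ peaksFrom j L
  preserved j (a ∷ b ∷ c ∷ r) = cong₂ (λ h R → if h then j ∷ R else R)
    (cong₂ _∧_ (lt-oddLift g g↑ g0 a b) (lt-oddLift g g↑ g0 c b)) (preserved (suc j) (b ∷ c ∷ r))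
  preserved j []           = refl
  preserved j (a ∷ [])     = refl
  preserved j (a ∷ b ∷ []) = refl

peak-split : (S : List ℕ) (k : ℕ) → Below S k → (π : List ℤ) →
  hasPeakSet (S ++ suc k ∷ []) π + (hasPeakSet S π + hasPeakSet (k ∷ S) π) ≡
  cut k (hasPeakSet S) noPeaks π
peak-split S k S<k π =
  trans (exactly-one (isPeak-adjacent π k)
                     (fitting false true (S ++ suc k ∷ []) (λ x → ∈ᵇ-snoc x S (suc k)))
                     (fitting false false S (λ x → sym (∨-identityʳ (x ∈ᵇ S))))
                     (fitting true false (k ∷ S)
                       (λ x → trans (∨-comm (x ≡ᵇ k) (x ∈ᵇ S)) (cong ((x ∈ᵇ S) ∨_) (sym (∨-identityʳ (x ≡ᵇ k))))))
                     outside)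
        (χ-∧ (peakSet (take k π) ≈ˢ S) (peakFree (drop k π)))
  where
  open Cut (isPeak π) k S S<k
  fitting : ∀ b₀ b₁ T → (∀ x → (x ∈ᵇ T) ≡ extend b₀ b₁ x) → (peakSet π ≈ˢ T) ≡ true ⇔ Fits b₀ b₁
  fitting b₀ b₁ T memb = mk⇔ (λ same x → trans (≈ˢ-sound (peakSet π) T same x) (memb x))
                       (λ fits → ≈ˢ-complete (peakSet π) T (λ x → trans (fits x) (sym (memb x))))
  outside : ((peakSet (take k π) ≈ˢ S) ∧ peakFree (drop k π)) ≡ true ⇔ Outside
  outside = mk⇔
    (λ both → let (low , high) = ∧-true _ _ both
              in Equivalence.to (prefix-peaks S k π S<k) low , Equivalence.to (suffix-peakFree k π) high)
    (λ (low , high) → cong₂ _∧_ (Equivalence.from (prefix-peaks S k π S<k) low)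
                                 (Equivalence.from (suffix-peakFree k π) high))

-- (6) The counting identity and the theorem.

sumList-witness : {A : Set} (g : A → ℕ) (xs : List A) → sumList g xs ≢ 0 → Σ A (λ a → g a ≢ 0)
sumList-witness g []       nz = ⊥-elim (nz refl)
sumList-witness g (x ∷ xs) nz with g x ℕ.≟ 0
... | yes gx≡0 = sumList-witness g xs (λ rest≡0 → nz (cong₂ _+_ gx≡0 rest≡0))
... | no  gx≢0 = x , gx≢0

sumWords-witness : (k : ℕ) (A : List ℤ) (f : List ℤ → ℕ) → sumWords k A f ≢ 0 →
                   Σ (List ℤ) (λ w → length w ≡ k × f w ≢ 0)
sumWords-witness zero    A f nz = [] , refl , nz
sumWords-witness (suc k) A f nz with sumList-witness (λ a → sumWords k A (λ w → f (a ∷ w))) A nz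
... | a , nz′ with sumWords-witness k A (λ w → f (a ∷ w)) nz′
...   | w , len , fw≢0 = a ∷ w , cong suc len , fw≢0

admissible-witness : (S : List ℕ) (n : ℕ) → countPB S n ≢ 0 →
                     Σ (List ℤ) (λ π → length π ≡ n × (peakSet π ≈ˢ S) ≡ true)
admissible-witness S n nz with sumWords-witness n (alphabet n) _ (λ e → nz (trans (countPB-sumB S n) e))
... | π , len , nonzero = π , len , indicated (isSigned π) (peakSet π ≈ˢ S) nonzero
  where
  indicated : ∀ a b → χ a * χ b ≢ 0 → b ≡ true
  indicated a true  _  = refl
  indicated a false nz = ⊥-elim (nz (*-zeroʳ (χ a)))

count-identity : (S : List ℕ) (k n : ℕ) → Below S k → suc (suc k) ≤ n →
  countPB (S ++ suc k ∷ []) n + (countPB S n + countPB (k ∷ S) n) ≡ (n C k) * countPB S k * 2 ^ (2 * (n ∸ suc k) + 1)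
count-identity S k n S<k 2+k≤n = begin
  countPB TA n + (countPB S n + countPB TC n)
    ≡⟨ cong₂ _+_ (countPB-sumB TA n) (cong₂ _+_ (countPB-sumB S n) (countPB-sumB TC n)) ⟩
  sumB n (hasPeakSet TA) + (sumB n (hasPeakSet S) + sumB n (hasPeakSet TC))
    ≡⟨ sym (trans (sumInj-+ n (alphabet n) (hasPeakSet TA) _)
                  (cong (_+_ (sumB n (hasPeakSet TA))) (sumInj-+ n (alphabet n) (hasPeakSet S) (hasPeakSet TC)))) ⟩
  sumB n (λ π → hasPeakSet TA π + (hasPeakSet S π + hasPeakSet TC π))
    ≡⟨ sumInj-cong n (alphabet n) (λ π _ _ → peak-split S k S<k π) ⟩
  sumB n F
    ≡⟨ cong (λ t → sumB t F) n≡k+1+m ⟩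
  sumB (k + suc m) F
    ≡⟨ product-formula k (suc m) (hasPeakSet S) noPeaks (hasPeakSet-invariant S) peakFree-invariant ⟩
  choose k (suc m) * (sumB k (hasPeakSet S) * sumB (suc m) noPeaks)
    ≡⟨ cong₂ _*_ (trans (choose-C k (suc m)) (cong (_C k) (sym n≡k+1+m)))
                 (cong₂ _*_ (sym (countPB-sumB S k)) (peakFree-count m)) ⟩
  (n C k) * (countPB S k * 2 ^ (2 * m + 1))
    ≡⟨ sym (*-assoc (n C k) (countPB S k) (2 ^ (2 * m + 1))) ⟩
  (n C k) * countPB S k * 2 ^ (2 * m + 1) ∎
  where
  open ≡-Reasoning
  TA = S ++ suc k ∷ []
  TC = k ∷ S
  F = cut k (hasPeakSet S) noPeaks
  m = n ∸ suc k
  n≡k+1+m : n ≡ k + suc m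
  n≡k+1+m = trans (sym (m+[n∸m]≡n (ℕ.<⇒≤ 2+k≤n))) (sym (+-suc k m))

All-∈ᵇ : {P : ℕ → Set} {xs : List ℕ} → All P xs → ∀ y → (y ∈ᵇ xs) ≡ true → P y
All-∈ᵇ {P} {x ∷ xs} (px ∷ pxs) y y∈ with y ≡ᵇ x in y≡ᵇx
... | true  = subst P (sym (ℕ.≡ᵇ⇒≡ y x (Equivalence.from T-≡ y≡ᵇx))) px
... | false = All-∈ᵇ pxs y y∈

-- Consequences of admissibility: the largest peak is some k+1 ≥ 1 (0 is never a peak), the other
-- peaks lie below k (peaks are not adjacent), and a peak at k+1 needs at least k+2 letters.
admissible-shape : (S₁ : List ℕ) (iₛ n : ℕ) → All (_< iₛ) S₁ → countPB (S₁ ++ iₛ ∷ []) n ≢ 0 →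
  Σ ℕ (λ k → iₛ ≡ suc k × Below S₁ k × suc (suc k) ≤ n)
admissible-shape S₁ zero n _ nz with admissible-witness (S₁ ++ 0 ∷ []) n nz
... | π , _ , fits = ⊥-elim (false≢true (trans (sym (isPeak-zero π)) (peak-of π (S₁ ++ 0 ∷ []) 0 fits (∈ᵇ-snoc-last S₁ 0))))
admissible-shape S₁ (suc k) n S₁<1+k nz with admissible-witness (S₁ ++ suc k ∷ []) n nz
... | π , len , fits = k , refl , S₁<k , subst (suc (suc k) ≤_) len long
  where
  peak-k+1 : isPeak π (suc k) ≡ true
  peak-k+1 = peak-of π (S₁ ++ suc k ∷ []) (suc k) fits (∈ᵇ-snoc-last S₁ (suc k))
  S₁<k : Below S₁ k
  S₁<k y y∈ with ℕ.m≤n⇒m<n∨m≡n (ℕ.≤-pred (All-∈ᵇ S₁<1+k y y∈))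
  ... | inj₁ y<k  = y<k
  ... | inj₂ refl =
    ⊥-elim (false≢true (trans (sym (isPeak-adjacent π y peak-y)) peak-k+1))
    where
    peak-y : isPeak π y ≡ true
    peak-y = peak-of π (S₁ ++ suc k ∷ []) y fits (∈ᵇ-snoc-init S₁ (suc k) y y∈)
  long : suc (suc k) ≤ length π
  long = ℕ.≤-pred (peakAt-length (+ 0 ∷ π) k (trans (sym (isPeak-suc π k)) peak-k+1))

difference : (a b c y : ℕ) → a + (b + c) ≡ y → + a ≡ + y - + b - + c
difference a b c y refl = begin
  + a                                  ≡⟨ cancel (+ a) (+ b) (+ c) ⟩
  + a ℤ+ (+ b ℤ+ + c) - + b - + c
    ≡⟨ cong (λ z → z - + b - + c) (sym (trans (ℤ.pos-+ a (b + c)) (cong (+ a ℤ+_) (ℤ.pos-+ b c)))) ⟩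
  + (a + (b + c)) - + b - + c          ∎
  where
  open ≡-Reasoning
  cancel : ∀ (x y z : ℤ) → x ≡ x ℤ+ (y ℤ+ z) - y - z
  cancel = ℤ-solve-∀

theorem3p2 : (S₁ : List ℕ) (iₛ n : ℕ) →
    All (_< iₛ) S₁ →
    NonZero (countPB (S₁ ++ iₛ ∷ []) n) →
    + countPB (S₁ ++ iₛ ∷ []) n ≡
      + ((n C (iₛ ∸ 1)) * countPB S₁ (iₛ ∸ 1) * 2 ^ (2 * (n ∸ iₛ) + 1))
        - + countPB S₁ n
        - + countPB ((iₛ ∸ 1) ∷ S₁) n
theorem3p2 S₁ iₛ n S₁<iₛ nonzero
  with admissible-shape S₁ iₛ n S₁<iₛ (≢-nonZero⁻¹ (countPB (S₁ ++ iₛ ∷ []) n) {{nonzero}})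
... | k , refl , S₁<k , 2+k≤n =
  difference (countPB (S₁ ++ suc k ∷ []) n) (countPB S₁ n) (countPB (k ∷ S₁) n) _
             (count-identity S₁ k n S₁<k 2+k≤n)
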